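{- For primes $p\geq 11$: $N_{5}(\mathbb{Z}_{p})=9$ if $p\in\{17,23\}$ or $p\geq 41$; $N_{5}(\mathbb{Z}_{p})=10$ if $p\in\{11,19,29,31,37\}$; $N_{5}(\mathbb{Z}_{p})=11$ if $p=13$.
   Context: $\mathbb{Z}_{p}$ denotes the field of integers modulo a prime $p$. For a ring $R$, let $S(R):=\{a^{2} : a\in R\}$ denote the set of squares in $R$ (including $0$). For a subset $A\subseteq R$, the sumset is $A+A:=\{a+b : a,b\in A\}$. For a positive integer $n$, define $N_{n}(R):=\inf\{\,|A+A| : A\subseteq S(R),\ |A|=n\,\}$. -}

module Defs where

open import Data.Nat using (ℕ; _+_; _*_; _≤_)
open import Data.Fin using (Fin; toℕ)
open import Data.Fin.Subset using (Subset; _∈_; ∣_∣)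
open import Data.Product using (Σ; ∃; ∃-syntax; _×_)
open import Data.Sum using (_⊎_)
open import Relation.Binary.PropositionalEquality using (_≡_)
open import Function.Bundles using (_⇔_)

-- Z_p is represented by Fin p (residues 0 .. p-1).

-- c is a square in Z_p : c ≡ x² (mod p) for some x ∈ Z_p.
-- Since toℕ c < p this is exactly  x * x = c + k * p  for some k.
IsSquare : (p : ℕ) → Fin p → Set
IsSquare p c = ∃[ x ] ∃[ k ] (toℕ {p} x * toℕ x ≡ toℕ c + k * p)

-- c ∈ A + A in Z_p : c = a + b (mod p) for some a, b ∈ A.
-- As 0 ≤ a + b < 2p, the reduction is either a + b or a + b - p.
InSumset : {p : ℕ} → Subset p → Fin p → Set
InSumset {p} A c =
  ∃[ a ] ∃[ b ] (a ∈ A × b ∈ A ×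
    (toℕ a + toℕ b ≡ toℕ c ⊎ toℕ a + toℕ b ≡ toℕ c + p))

SumsetCard : {p : ℕ} → Subset p → ℕ → Set
SumsetCard {p} A k = Σ (Subset p) λ B → ((c : Fin p) → (c ∈ B ⇔ InSumset A c)) × ∣ B ∣ ≡ k

SquareSubset : (p n : ℕ) → Subset p → Set
SquareSubset p n A = ((c : Fin p) → c ∈ A → IsSquare p c) × ∣ A ∣ ≡ n

IsN : (n p m : ℕ) → Set
IsN n p m =
  (∃[ A ] (SquareSubset p n A × SumsetCard A m)) ×
  ((A : Subset p) → SquareSubset p n A → (k : ℕ) → SumsetCard A k → m ≤ k)

-- Lower bound: by the Cauchy–Davenport theorem (proved with Dyson's e-transform),
-- |A + A| ≥ min(p, 2|A| - 1) ≥ 9 for every five residues modulo p ≥ 11.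
--
-- Upper bound for p ≥ 41: a five-term arithmetic progression has exactly nine pairwise sums,
-- so it suffices to find one made of squares. The Legendre symbol is multiplicative (by a
-- counting argument), so the symbols of -1, 2, 3, 5, 7, 11, 13, 17 decide which integers of
-- absolute value at most 100 are squares, and for each of the 2⁸ sign patterns a tabulated
-- progression with common difference below 41 consists of squares.
--
-- For the primes 11 ≤ p ≤ 37 a set attaining the value is exhibited; where the value exceeds 9,
-- all five-element sets of squares are checked exhaustively.

module Submission where

open import Defs
open import Data.Bool using (Bool; true; false; _∧_; _∨_; not; if_then_else_)
import Data.Bool.Properties as Boolₚ
open import Data.Bool.Properties using (∧-conicalˡ; ∧-conicalʳ; ∧-comm; ∧-zeroʳ; T-≡)
import Data.Integer.Properties as ℤₚ
open import Data.Empty using (⊥; ⊥-elim)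
open import Data.Fin using (Fin; toℕ; fromℕ<; remQuot; combine) renaming (suc to fsuc)
open import Data.Fin.Subset using (Subset; _∈_; _⊆_; ∣_∣)
open import Data.Fin.Subset.Properties using (drop-∷-⊆)
import Data.Fin.Properties as Finₚ
open import Data.Fin.Patterns using (0F; 1F; 2F)
open import Data.Nat
open import Data.Nat.Properties
open import Data.Nat.DivMod
open import Data.Nat.Divisibility using (_∣_; _∣?_; divides; quotient; ∣⇒≤; m%n≡0⇒n∣m; n∣m⇒m%n≡0)
open import Data.Nat.Primality using (Prime; prime⇒nonZero; prime⇒irreducible; euclidsLemma)
open import Data.Nat.Coprimality using (prime⇒coprime; coprime-Bézout)
open import Data.Nat.GCD using (module Bézout)
open import Data.Nat.Tactic.RingSolver using (solve-∀)
open import Data.Sign as Sign using (Sign)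
open import Data.Integer as ℤ using (ℤ; _◃_)
open import Data.Product using (Σ; ∃; ∃₂; _×_; _,_; proj₁; proj₂; uncurry)
open import Data.Sum using (_⊎_; inj₁; inj₂)
open import Data.List using (List; []; _∷_; map; _++_; length; foldr; upTo; applyUpTo; allFin; deduplicate)
open import Data.List.Relation.Unary.All using (All)
import Data.List.Relation.Unary.All as All
open import Data.List.Relation.Unary.Any using (here; there)
open import Data.List.Relation.Unary.Unique.Propositional using (Unique; []; _∷_)
open import Data.List.Relation.Unary.Unique.Propositional.Properties using (applyUpTo⁺₁)
open import Data.List.Properties using (length-applyUpTo)
open import Data.List.Relation.Unary.Unique.DecPropositional.Properties _≟_ using (deduplicate-!)
open import Data.List.Membership.Propositional using () renaming (_∈_ to _∈ₗ_)
open import Data.List.Membership.DecPropositional _≟_ using (_∈?_)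
open import Data.List.Membership.Propositional.Properties
  using (∈-applyUpTo⁺; ∈-applyUpTo⁻; ∈-deduplicate⁺; ∈-deduplicate⁻; ∈-map⁺; ∈-map⁻; ∈-++⁺ˡ; ∈-++⁺ʳ; ∈-++⁻; ∈-upTo⁺)
import Data.Vec as Vec
open import Data.Vec using (Vec; []; _∷_; lookup; tabulate)
open import Data.Vec.Properties using (lookup∘tabulate; []=⇒lookup; lookup⇒[]=)
open import Function.Base using (_∘_)
open import Function.Bundles using (_⇔_; mk⇔; Equivalence)
open import Relation.Binary.Bundles using (Setoid)
open import Relation.Binary.PropositionalEquality
open import Relation.Binary.Definitions using (tri<; tri≈; tri>)
open import Relation.Nullary using (¬_; Dec; yes; no; does)
open import Relation.Nullary.Decidable using (dec-true; dec-false; from-yes; map′; _×-dec_)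

-- Subsets of [0, n) as Boolean predicates

indicator : Bool → ℕ
indicator b = if b then 1 else 0

count : ℕ → (ℕ → Bool) → ℕ
count zero f = 0
count (suc n) f = indicator (f 0) + count n (f ∘ suc)

count-cong : ∀ n {f g} → (∀ x → x < n → f x ≡ g x) → count n f ≡ count n g
count-cong zero f≡g = refl
count-cong (suc n) f≡g =
  cong₂ _+_ (cong indicator (f≡g 0 z<s)) (count-cong n (λ x x<n → f≡g (suc x) (s<s x<n)))

indicator-mono : ∀ {a b} → (a ≡ true → b ≡ true) → indicator a ≤ indicator b
indicator-mono {false} _ = z≤n
indicator-mono {true} a⇒b rewrite a⇒b refl = ≤-refl

count-mono : ∀ n {f g} → (∀ x → x < n → f x ≡ true → g x ≡ true) → count n f ≤ count n g
count-mono zero f⊆g = z≤n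
count-mono (suc n) f⊆g =
  +-mono-≤ (indicator-mono (f⊆g 0 z<s)) (count-mono n (λ x x<n → f⊆g (suc x) (s<s x<n)))

count-mono-< : ∀ n {f g} → (∀ x → x < n → f x ≡ true → g x ≡ true) →
               ∀ y → y < n → f y ≡ false → g y ≡ true → count n f < count n g
count-mono-< (suc n) f⊆g zero _ fy≡false gy≡true rewrite fy≡false | gy≡true =
  s≤s (count-mono n (λ x x<n → f⊆g (suc x) (s<s x<n)))
count-mono-< (suc n) f⊆g (suc y) (s<s y<n) fy≡false gy≡true =
  +-mono-≤-< (indicator-mono (f⊆g 0 z<s)) (count-mono-< n (λ x x<n → f⊆g (suc x) (s<s x<n)) y y<n fy≡false gy≡true)

count-all : ∀ n f → (∀ x → x < n → f x ≡ true) → count n f ≡ n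
count-all zero f _ = refl
count-all (suc n) f all rewrite all 0 z<s = cong suc (count-all n (f ∘ suc) (λ x x<n → all (suc x) (s<s x<n)))

count-none : ∀ n f → (∀ x → x < n → f x ≡ false) → count n f ≡ 0
count-none zero f _ = refl
count-none (suc n) f none rewrite none 0 z<s = count-none n (f ∘ suc) (λ x x<n → none (suc x) (s<s x<n))

count-witness : ∀ n f → 0 < count n f → ∃ λ x → x < n × f x ≡ true
count-witness (suc n) f 0<count with f 0 in f0≡true
... | true = 0 , z<s , f0≡true
... | false with count-witness n (f ∘ suc) 0<count
...   | x , x<n , fx = suc x , s<s x<n , fx

witness⇒0<count : ∀ n f x → x < n → f x ≡ true → 0 < count n f
witness⇒0<count (suc n) f zero _ f0≡true rewrite f0≡true = z<s
witness⇒0<count (suc n) f (suc x) (s<s x<n) fx≡true =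
  ≤-trans (witness⇒0<count n (f ∘ suc) x x<n fx≡true) (m≤n+m _ (indicator (f 0)))

count-two-witnesses : ∀ n f → 1 < count n f →
  ∃₂ λ x y → x < n × y < n × x ≢ y × f x ≡ true × f y ≡ true
count-two-witnesses (suc n) f 1<count with f 0 in f0≡true
... | true with count-witness n (f ∘ suc) (s≤s⁻¹ 1<count)
...   | y , y<n , fy = 0 , suc y , z<s , s<s y<n , (λ ()) , f0≡true , fy
count-two-witnesses (suc n) f 1<count | false with count-two-witnesses n (f ∘ suc) 1<count
...   | x , y , x<n , y<n , x≢y , fx , fy =
  suc x , suc y , s<s x<n , s<s y<n , x≢y ∘ suc-injective , fx , fy

count-∨-∧ : ∀ n f g → count n (λ x → f x ∨ g x) + count n (λ x → f x ∧ g x) ≡ count n f + count n g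
count-∨-∧ zero f g = refl
count-∨-∧ (suc n) f g = begin
  (i∨ + c∨) + (i∧ + c∧)   ≡⟨ +-assoc i∨ c∨ (i∧ + c∧) ⟩
  i∨ + (c∨ + (i∧ + c∧))   ≡⟨ cong (i∨ +_) (x+[y+z]≡y+[x+z] c∨ i∧ c∧) ⟩
  i∨ + (i∧ + (c∨ + c∧))   ≡⟨ +-assoc i∨ i∧ (c∨ + c∧) ⟨
  (i∨ + i∧) + (c∨ + c∧)   ≡⟨ cong₂ _+_ (indicator-∨-∧ (f 0) (g 0)) (count-∨-∧ n (f ∘ suc) (g ∘ suc)) ⟩
  (i f + i g) + (cf + cg) ≡⟨ +-assoc (i f) (i g) (cf + cg) ⟩
  i f + (i g + (cf + cg)) ≡⟨ cong (i f +_) (x+[y+z]≡y+[x+z] (i g) cf cg) ⟩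
  i f + (cf + (i g + cg)) ≡⟨ +-assoc (i f) cf (i g + cg) ⟨
  (i f + cf) + (i g + cg) ∎
  where
  open ≡-Reasoning
  i : (ℕ → Bool) → ℕ
  i h = indicator (h 0)
  i∨ = indicator (f 0 ∨ g 0)
  i∧ = indicator (f 0 ∧ g 0)
  c∨ = count n (λ x → f (suc x) ∨ g (suc x))
  c∧ = count n (λ x → f (suc x) ∧ g (suc x))
  cf = count n (f ∘ suc)
  cg = count n (g ∘ suc)
  x+[y+z]≡y+[x+z] : ∀ x y z → x + (y + z) ≡ y + (x + z)
  x+[y+z]≡y+[x+z] = solve-∀
  indicator-∨-∧ : ∀ a b → indicator (a ∨ b) + indicator (a ∧ b) ≡ indicator a + indicator b
  indicator-∨-∧ true true = refl
  indicator-∨-∧ true false = refl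
  indicator-∨-∧ false true = refl
  indicator-∨-∧ false false = refl

count-suc : ∀ n f → count (suc n) f ≡ count n f + indicator (f n)
count-suc zero f = +-comm (indicator (f 0)) 0
count-suc (suc n) f =
  trans (cong (indicator (f 0) +_) (count-suc n (f ∘ suc))) (sym (+-assoc (indicator (f 0)) _ _))

count-rotate : ∀ n .{{_ : NonZero n}} f → count n (λ x → f ((x + 1) % n)) ≡ count n f
count-rotate (suc k) f = begin
  count (suc k) (f ∘ rotate)                        ≡⟨ count-suc k (f ∘ rotate) ⟩
  count k (f ∘ rotate) + indicator (f (rotate k))   ≡⟨ +-comm (count k (f ∘ rotate)) _ ⟩
  indicator (f (rotate k)) + count k (f ∘ rotate)   ≡⟨ cong₂ _+_ (cong (indicator ∘ f) rotate-last) rotate-rest ⟩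
  indicator (f 0) + count k (f ∘ suc)               ∎
  where
  open ≡-Reasoning
  rotate : ℕ → ℕ
  rotate x = (x + 1) % suc k
  rotate-last : rotate k ≡ 0
  rotate-last = trans (cong (_% suc k) (+-comm k 1)) (n%n≡0 (suc k))
  rotate-rest : count k (f ∘ rotate) ≡ count k (f ∘ suc)
  rotate-rest = count-cong k λ x x<k → cong f (trans (cong (_% suc k) (+-comm x 1)) (m<n⇒m%n≡m (s<s x<k)))

anyBelow : ℕ → (ℕ → Bool) → Bool
anyBelow zero f = false
anyBelow (suc n) f = f n ∨ anyBelow n f

anyBelow-sound : ∀ n f → anyBelow n f ≡ true → ∃ λ x → x < n × f x ≡ true
anyBelow-sound (suc n) f any≡true with f n in fn≡true
... | true = n , ≤-refl , fn≡true
... | false with anyBelow-sound n f any≡true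
...   | x , x<n , fx = x , m<n⇒m<1+n x<n , fx

anyBelow-complete : ∀ n f x → x < n → f x ≡ true → anyBelow n f ≡ true
anyBelow-complete (suc n) f x x<1+n fx≡true with f n in fn
... | true = refl
... | false with x ≟ n
...   | no x≢n = anyBelow-complete n f x (≤∧≢⇒< (s≤s⁻¹ x<1+n) x≢n) fx≡true
...   | yes refl with trans (sym fn) fx≡true
...     | ()

infix 7 _∈ᵇ_
_∈ᵇ_ : ℕ → List ℕ → Bool
x ∈ᵇ xs = does (x ∈? xs)

does⇒ : ∀ {A : Set} (a? : Dec A) → does a? ≡ true → A
does⇒ (yes a) _ = a

∈ᵇ⇒∈ : ∀ {x xs} → x ∈ᵇ xs ≡ true → x ∈ₗ xs
∈ᵇ⇒∈ {x} {xs} = does⇒ (x ∈? xs)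

∈⇒∈ᵇ : ∀ {x xs} → x ∈ₗ xs → x ∈ᵇ xs ≡ true
∈⇒∈ᵇ {x} {xs} = dec-true (x ∈? xs)

count-≟ : ∀ n {y} → y < n → count n (λ c → does (c ≟ y)) ≡ 1
count-≟ (suc n) {zero} _ = cong suc (count-none n _ (λ _ _ → refl))
count-≟ (suc n) {suc y} (s<s y<n) = count-≟ n y<n

count-∈-unique : ∀ n {xs} → Unique xs → (∀ {x} → x ∈ₗ xs → x < n) → count n (_∈ᵇ xs) ≡ length xs
count-∈-unique n {[]} [] _ = count-none n _ (λ _ _ → refl)
count-∈-unique n {x ∷ xs} (x∉xs ∷ unique) bounded = begin
  count n (_∈ᵇ (x ∷ xs))
    ≡⟨ +-identityʳ _ ⟨
  count n (_∈ᵇ (x ∷ xs)) + 0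
    ≡⟨ cong (count n (_∈ᵇ (x ∷ xs)) +_) disjoint ⟨
  count n (_∈ᵇ (x ∷ xs)) + count n (λ c → does (c ≟ x) ∧ c ∈ᵇ xs)
    ≡⟨ count-∨-∧ n (λ c → does (c ≟ x)) (_∈ᵇ xs) ⟩
  count n (λ c → does (c ≟ x)) + count n (_∈ᵇ xs)
    ≡⟨ cong₂ _+_ (count-≟ n (bounded (here refl))) (count-∈-unique n unique (bounded ∘ there)) ⟩
  1 + length xs
    ∎
  where
  open ≡-Reasoning
  disjoint : count n (λ c → does (c ≟ x) ∧ c ∈ᵇ xs) ≡ 0
  disjoint = count-none n _ λ c _ → lemma c
    where
    lemma : ∀ c → does (c ≟ x) ∧ c ∈ᵇ xs ≡ false
    lemma c with c ≟ x
    ... | no c≢x = cong (_∧ c ∈ᵇ xs) (dec-false (c ≟ x) c≢x)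
    ... | yes refl = cong₂ _∧_ (dec-true (c ≟ c) refl) (dec-false (c ∈? xs) λ c∈xs → All.lookup x∉xs c∈xs refl)

pairSums : List ℕ → List ℕ
pairSums [] = []
pairSums (x ∷ xs) = map (x +_) (x ∷ xs) ++ pairSums xs

∈-pairSums⁺ : ∀ {a b xs} → a ∈ₗ xs → b ∈ₗ xs → a + b ∈ₗ pairSums xs
∈-pairSums⁺ {xs = x ∷ xs} (here refl) b∈ = ∈-++⁺ˡ (∈-map⁺ (x +_) b∈)
∈-pairSums⁺ {a} {xs = x ∷ xs} (there a∈) (here refl) =
  ∈-++⁺ˡ {ys = pairSums xs} (subst (_∈ₗ map (x +_) (x ∷ xs)) (+-comm x a) (∈-map⁺ (x +_) (there a∈)))
∈-pairSums⁺ {xs = x ∷ xs} (there a∈) (there b∈) = ∈-++⁺ʳ (map (x +_) (x ∷ xs)) (∈-pairSums⁺ a∈ b∈)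

∈-pairSums⁻ : ∀ {c} xs → c ∈ₗ pairSums xs → ∃₂ λ a b → a ∈ₗ xs × b ∈ₗ xs × c ≡ a + b
∈-pairSums⁻ (x ∷ xs) c∈ with ∈-++⁻ (map (x +_) (x ∷ xs)) c∈
... | inj₁ c∈map with ∈-map⁻ (x +_) c∈map
...   | b , b∈ , c≡x+b = x , b , here refl , b∈ , c≡x+b
∈-pairSums⁻ (x ∷ xs) c∈ | inj₂ c∈rest with ∈-pairSums⁻ xs c∈rest
...   | a , b , a∈ , b∈ , c≡a+b = a , b , there a∈ , there b∈ , c≡a+b

contains : ∀ {n} → Subset n → ℕ → Bool
contains [] _ = false
contains (b ∷ A) zero = b
contains (b ∷ A) (suc x) = contains A x

contains-lookup : ∀ {n} (A : Subset n) (i : Fin n) → contains A (toℕ i) ≡ lookup A i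
contains-lookup (b ∷ A) 0F = refl
contains-lookup (b ∷ A) (fsuc i) = contains-lookup A i

contains-< : ∀ {n} (A : Subset n) x → contains A x ≡ true → x < n
contains-< (b ∷ A) zero _ = z<s
contains-< (b ∷ A) (suc x) x∈A = s<s (contains-< A x x∈A)

∈⇒contains : ∀ {n} {A : Subset n} {i} → i ∈ A → contains A (toℕ i) ≡ true
∈⇒contains {A = A} {i} i∈A = trans (contains-lookup A i) ([]=⇒lookup i∈A)

contains⇒∈ : ∀ {n} {A : Subset n} {i} → contains A (toℕ i) ≡ true → i ∈ A
contains⇒∈ {A = A} {i} e = lookup⇒[]= i A (trans (sym (contains-lookup A i)) e)

contains-fromℕ< : ∀ {n} {A : Subset n} {x} (x<n : x < n) → contains A x ≡ true → fromℕ< x<n ∈ A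
contains-fromℕ< {A = A} x<n e = contains⇒∈ (subst (λ t → contains A t ≡ true) (sym (Finₚ.toℕ-fromℕ< x<n)) e)

∣∣≡count : ∀ {n} (A : Subset n) → ∣ A ∣ ≡ count n (contains A)
∣∣≡count [] = refl
∣∣≡count (true ∷ A) = cong suc (∣∣≡count A)
∣∣≡count (false ∷ A) = ∣∣≡count A

fromPredicate : ∀ n → (ℕ → Bool) → Subset n
fromPredicate n h = tabulate (h ∘ toℕ)

contains-fromPredicate : ∀ n h x → x < n → contains (fromPredicate n h) x ≡ h x
contains-fromPredicate n h x x<n = begin
  contains (fromPredicate n h) x                   ≡⟨ cong (contains (fromPredicate n h)) (Finₚ.toℕ-fromℕ< x<n) ⟨
  contains (fromPredicate n h) (toℕ (fromℕ< x<n))  ≡⟨ contains-lookup (fromPredicate n h) (fromℕ< x<n) ⟩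
  lookup (fromPredicate n h) (fromℕ< x<n)          ≡⟨ lookup∘tabulate (h ∘ toℕ) (fromℕ< x<n) ⟩
  h (toℕ (fromℕ< x<n))                             ≡⟨ cong h (Finₚ.toℕ-fromℕ< x<n) ⟩
  h x                                              ∎
  where open ≡-Reasoning

∣fromPredicate∣ : ∀ n h → ∣ fromPredicate n h ∣ ≡ count n h
∣fromPredicate∣ n h = trans (∣∣≡count (fromPredicate n h)) (count-cong n (contains-fromPredicate n h))

elements : ∀ {n} → Subset n → List ℕ
elements [] = []
elements (true ∷ A) = 0 ∷ map suc (elements A)
elements (false ∷ A) = map suc (elements A)

∈-elements⁺ : ∀ {n} {A : Subset n} {x} → contains A x ≡ true → x ∈ₗ elements A
∈-elements⁺ {A = true ∷ A} {zero} _ = here refl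
∈-elements⁺ {A = true ∷ A} {suc x} x∈A = there (∈-map⁺ suc (∈-elements⁺ {A = A} x∈A))
∈-elements⁺ {A = false ∷ A} {suc x} x∈A = ∈-map⁺ suc (∈-elements⁺ {A = A} x∈A)

∈-elements⁻ : ∀ {n} {A : Subset n} {x} → x ∈ₗ elements A → contains A x ≡ true
∈-elements⁻ {A = true ∷ A} (here refl) = refl
∈-elements⁻ {A = true ∷ A} (there x∈) = ∈-map-suc⁻ x∈
  where
  ∈-map-suc⁻ : ∀ {x} → x ∈ₗ map suc (elements A) → contains (true ∷ A) x ≡ true
  ∈-map-suc⁻ x∈ with ∈-map⁻ suc x∈
  ... | y , y∈ , refl = ∈-elements⁻ {A = A} y∈
∈-elements⁻ {A = false ∷ A} x∈ with ∈-map⁻ suc x∈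
... | y , y∈ , refl = ∈-elements⁻ {A = A} y∈

subsetsOfSize : ∀ {n} → Subset n → ℕ → List (Subset n)
subsetsOfSize [] zero = [] ∷ []
subsetsOfSize [] (suc k) = []
subsetsOfSize (false ∷ M) k = map (false ∷_) (subsetsOfSize M k)
subsetsOfSize (true ∷ M) zero = map (false ∷_) (subsetsOfSize M zero)
subsetsOfSize (true ∷ M) (suc k) = map (true ∷_) (subsetsOfSize M k) ++ map (false ∷_) (subsetsOfSize M (suc k))

∈-subsetsOfSize : ∀ {n} {A M : Subset n} → A ⊆ M → A ∈ₗ subsetsOfSize M ∣ A ∣
∈-subsetsOfSize {A = []} {[]} _ = here refl
∈-subsetsOfSize {A = true ∷ A} {m ∷ M} A⊆M with A⊆M Vec.here
... | Vec.here = ∈-++⁺ˡ (∈-map⁺ (true ∷_) (∈-subsetsOfSize (drop-∷-⊆ A⊆M)))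
∈-subsetsOfSize {A = false ∷ A} {false ∷ M} A⊆M = ∈-map⁺ (false ∷_) (∈-subsetsOfSize (drop-∷-⊆ A⊆M))
∈-subsetsOfSize {A = false ∷ A} {true ∷ M} A⊆M with ∣ A ∣ | ∈-subsetsOfSize {A = A} (drop-∷-⊆ A⊆M)
... | zero | A∈ = ∈-map⁺ (false ∷_) A∈
... | suc k | A∈ = ∈-++⁺ʳ (map (true ∷_) (subsetsOfSize M k)) (∈-map⁺ (false ∷_) A∈)

-- Arithmetic modulo m

module Congruence (m : ℕ) .{{_ : NonZero m}} where

  infix 4 _≈_
  record _≈_ (a b : ℕ) : Set where
    constructor mod-≡
    field %-≡ : a % m ≡ b % m
  open _≈_ public

  ≈-refl : ∀ {a} → a ≈ a
  ≈-refl = mod-≡ refl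

  ≈-sym : ∀ {a b} → a ≈ b → b ≈ a
  ≈-sym (mod-≡ e) = mod-≡ (sym e)

  ≈-trans : ∀ {a b c} → a ≈ b → b ≈ c → a ≈ c
  ≈-trans (mod-≡ e) (mod-≡ f) = mod-≡ (trans e f)

  ≈-reflexive : ∀ {a b} → a ≡ b → a ≈ b
  ≈-reflexive refl = ≈-refl

  ≈-setoid : Setoid _ _
  ≈-setoid = record
    { Carrier = ℕ ; _≈_ = _≈_
    ; isEquivalence = record { refl = ≈-refl ; sym = ≈-sym ; trans = ≈-trans } }

  module ≈-Reasoning where
    open import Relation.Binary.Reasoning.Setoid ≈-setoid public

  +-cong : ∀ {a b c d} → a ≈ b → c ≈ d → a + c ≈ b + d
  +-cong {a} {b} {c} {d} (mod-≡ e) (mod-≡ f) = mod-≡ (begin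
    (a + c) % m           ≡⟨ %-distribˡ-+ a c m ⟩
    (a % m + c % m) % m   ≡⟨ cong₂ (λ x y → (x + y) % m) e f ⟩
    (b % m + d % m) % m   ≡⟨ %-distribˡ-+ b d m ⟨
    (b + d) % m           ∎)
    where open ≡-Reasoning

  *-cong : ∀ {a b c d} → a ≈ b → c ≈ d → a * c ≈ b * d
  *-cong {a} {b} {c} {d} (mod-≡ e) (mod-≡ f) = mod-≡ (begin
    (a * c) % m             ≡⟨ %-distribˡ-* a c m ⟩
    (a % m * (c % m)) % m   ≡⟨ cong₂ (λ x y → (x * y) % m) e f ⟩
    (b % m * (d % m)) % m   ≡⟨ %-distribˡ-* b d m ⟨
    (b * d) % m             ∎)
    where open ≡-Reasoning

  +-congˡ : ∀ a {b c} → b ≈ c → a + b ≈ a + c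
  +-congˡ a = +-cong (≈-refl {a})

  +-congʳ : ∀ a {b c} → b ≈ c → b + a ≈ c + a
  +-congʳ a e = +-cong e (≈-refl {a})

  *-congˡ : ∀ a {b c} → b ≈ c → a * b ≈ a * c
  *-congˡ a = *-cong (≈-refl {a})

  *-congʳ : ∀ a {b c} → b ≈ c → b * a ≈ c * a
  *-congʳ a e = *-cong e (≈-refl {a})

  %-≈ : ∀ a → a % m ≈ a
  %-≈ a = mod-≡ (m%n%n≡m%n a m)

  ≈⇒≡ : ∀ {a b} → a < m → b < m → a ≈ b → a ≡ b
  ≈⇒≡ a<m b<m (mod-≡ e) = trans (sym (m<n⇒m%n≡m a<m)) (trans e (m<n⇒m%n≡m b<m))

  ≈⇒%≡ : ∀ {a b} → b < m → a ≈ b → a % m ≡ b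
  ≈⇒%≡ b<m (mod-≡ e) = trans e (m<n⇒m%n≡m b<m)

  private
    0%m≡0 : 0 % m ≡ 0
    0%m≡0 = m<n⇒m%n≡m (>-nonZero⁻¹ m)

  ≈0⇒∣ : ∀ {a} → a ≈ 0 → m ∣ a
  ≈0⇒∣ {a} (mod-≡ e) = m%n≡0⇒n∣m a m (trans e 0%m≡0)

  ∣⇒≈0 : ∀ {a} → m ∣ a → a ≈ 0
  ∣⇒≈0 {a} m∣a = mod-≡ (trans (n∣m⇒m%n≡0 a m m∣a) (sym 0%m≡0))

  m≈0 : m ≈ 0
  m≈0 = mod-≡ (trans (n%n≡0 m) (sym 0%m≡0))

  *m≈0 : ∀ k → k * m ≈ 0
  *m≈0 k = mod-≡ (trans (m*n%n≡0 k m) (sym 0%m≡0))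

  m*≈0 : ∀ k → m * k ≈ 0
  m*≈0 k = subst (_≈ 0) (*-comm k m) (*m≈0 k)

  [x+[m∸e]]+e≈x : ∀ x {e} → e ≤ m → x + (m ∸ e) + e ≈ x
  [x+[m∸e]]+e≈x x {e} e≤m = begin
    x + (m ∸ e) + e   ≡⟨ +-assoc x (m ∸ e) e ⟩
    x + (m ∸ e + e)   ≡⟨ cong (x +_) (m∸n+n≡m e≤m) ⟩
    x + m             ≈⟨ +-congˡ x m≈0 ⟩
    x + 0             ≡⟨ +-identityʳ x ⟩
    x                 ∎
    where open ≈-Reasoning

  [x+e]+[m∸e]≈x : ∀ x {e} → e ≤ m → x + e + (m ∸ e) ≈ x
  [x+e]+[m∸e]≈x x {e} e≤m = begin
    x + e + (m ∸ e)   ≡⟨ +-assoc x e (m ∸ e) ⟩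
    x + (e + (m ∸ e)) ≡⟨ cong (x +_) (m+[n∸m]≡n e≤m) ⟩
    x + m             ≈⟨ +-congˡ x m≈0 ⟩
    x + 0             ≡⟨ +-identityʳ x ⟩
    x                 ∎
    where open ≈-Reasoning

  +-cancelʳ-≈ : ∀ c {a b} → a + c ≈ b + c → a ≈ b
  +-cancelʳ-≈ c {a} {b} e = begin
    a                           ≈⟨ [x+e]+[m∸e]≈x a c%m≤m ⟨
    a + c % m + (m ∸ c % m)     ≈⟨ +-congʳ (m ∸ c % m) (+-congˡ a (%-≈ c)) ⟩
    a + c + (m ∸ c % m)         ≈⟨ +-congʳ (m ∸ c % m) e ⟩
    b + c + (m ∸ c % m)         ≈⟨ +-congʳ (m ∸ c % m) (+-congˡ b (%-≈ c)) ⟨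
    b + c % m + (m ∸ c % m)     ≈⟨ [x+e]+[m∸e]≈x b c%m≤m ⟩
    b                           ∎
    where
    open ≈-Reasoning
    c%m≤m : c % m ≤ m
    c%m≤m = m%n≤n c m

  +-cancelˡ-≈ : ∀ c {a b} → c + a ≈ c + b → a ≈ b
  +-cancelˡ-≈ c {a} {b} e = +-cancelʳ-≈ c (subst₂ _≈_ (+-comm c a) (+-comm c b) e)

  ∸-≈0 : ∀ {u v} → u ≤ v → u ≈ v → v ∸ u ≈ 0
  ∸-≈0 {u} {v} u≤v e = +-cancelʳ-≈ u (≈-trans (≈-reflexive (m∸n+n≡m u≤v)) (≈-sym e))

  count-translate : ∀ e f → count m (λ x → f ((x + e) % m)) ≡ count m f
  count-translate zero f = count-cong m λ x x<m → cong f (trans (cong (_% m) (+-identityʳ x)) (m<n⇒m%n≡m x<m))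
  count-translate (suc e) f = begin
    count m (λ x → f ((x + suc e) % m))         ≡⟨ count-cong m (λ x _ → cong f (%-≡ (shift x))) ⟩
    count m (λ x → f (((x + 1) % m + e) % m))   ≡⟨ count-rotate m (λ y → f ((y + e) % m)) ⟩
    count m (λ y → f ((y + e) % m))             ≡⟨ count-translate e f ⟩
    count m f                                   ∎
    where
    open ≡-Reasoning
    shift : ∀ x → x + suc e ≈ (x + 1) % m + e
    shift x = ≈-trans (≈-reflexive (sym (+-assoc x 1 e))) (+-congʳ e (≈-sym (%-≈ (x + 1))))

-- The field ℤₚ and its squares

module PrimeField (p : ℕ) (p-prime : Prime p) where

  instance
    p≢0 : NonZero p
    p≢0 = prime⇒nonZero p-prime

  open Congruence p public

  0<a<p⇒a≉0 : ∀ {a} → 0 < a → a < p → ¬ a ≈ 0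
  0<a<p⇒a≉0 {a} 0<a a<p a≈0 = <⇒≱ a<p (∣⇒≤ ⦃ >-nonZero 0<a ⦄ (≈0⇒∣ a≈0))

  *-≉0 : ∀ {a b} → ¬ a ≈ 0 → ¬ b ≈ 0 → ¬ a * b ≈ 0
  *-≉0 {a} {b} a≉0 b≉0 ab≈0 with euclidsLemma a b p-prime (≈0⇒∣ ab≈0)
  ... | inj₁ p∣a = a≉0 (∣⇒≈0 p∣a)
  ... | inj₂ p∣b = b≉0 (∣⇒≈0 p∣b)

  -- Bézout for r = a % p and p gives y r = 1 + x p or 1 + y r = x p (ℕ has no negative
  -- coefficients); in the second case y r ≈ -1, so y² r is an inverse of r.
  *-inverse : ∀ {a} → ¬ a ≈ 0 → ∃ λ z → a * z ≈ 1
  *-inverse {a} a≉0 = from-Bézout (coprime-Bézout (prime⇒coprime p-prime ⦃ r≢0 ⦄ (m%n<n a p)))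
    where
    r = a % p
    r≢0 : NonZero r
    r≢0 = ≢-nonZero λ r≡0 → a≉0 (≈-trans (≈-sym (%-≈ a)) (≈-reflexive r≡0))
    square-of-neg-one : ∀ u → 1 + u ≈ 0 → u * u ≈ 1
    square-of-neg-one u 1+u≈0 = +-cancelʳ-≈ u (begin
      u * u + u       ≡⟨ +-comm (u * u) u ⟩
      u + u * u       ≡⟨ *-suc u u ⟨
      u * (1 + u)     ≈⟨ *-congˡ u 1+u≈0 ⟩
      u * 0           ≡⟨ *-zeroʳ u ⟩
      0               ≈⟨ 1+u≈0 ⟨
      1 + u           ∎)
      where open ≈-Reasoning
    from-Bézout : Bézout.Identity 1 p r → ∃ λ z → a * z ≈ 1
    from-Bézout (Bézout.-+ x y eq) = y , (begin
      a * y           ≈⟨ *-congʳ y (%-≈ a) ⟨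
      r * y           ≡⟨ *-comm r y ⟩
      y * r           ≡⟨ eq ⟨
      1 + x * p       ≈⟨ +-congˡ 1 (*m≈0 x) ⟩
      1 + 0           ∎)
      where open ≈-Reasoning
    from-Bézout (Bézout.+- x y eq) = y * y * r , (begin
      a * (y * y * r)       ≈⟨ *-congʳ (y * y * r) (%-≈ a) ⟨
      r * (y * y * r)       ≡⟨ rearrange r y ⟩
      y * r * (y * r)       ≈⟨ square-of-neg-one (y * r) (≈-trans (≈-reflexive eq) (*m≈0 x)) ⟩
      1                     ∎)
      where
      open ≈-Reasoning
      rearrange : ∀ r y → r * (y * y * r) ≡ y * r * (y * r)
      rearrange = solve-∀

  *-cancelʳ-≈ : ∀ {a b c} → ¬ c ≈ 0 → a * c ≈ b * c → a ≈ b
  *-cancelʳ-≈ {a} {b} {c} c≉0 ac≈bc with *-inverse c≉0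
  ... | z , cz≈1 = begin
    a             ≡⟨ *-identityʳ a ⟨
    a * 1         ≈⟨ *-congˡ a cz≈1 ⟨
    a * (c * z)   ≡⟨ *-assoc a c z ⟨
    a * c * z     ≈⟨ *-congʳ z ac≈bc ⟩
    b * c * z     ≡⟨ *-assoc b c z ⟩
    b * (c * z)   ≈⟨ *-congˡ b cz≈1 ⟩
    b * 1         ≡⟨ *-identityʳ b ⟩
    b             ∎
    where open ≈-Reasoning

  *-cancelˡ-≈ : ∀ {a b c} → ¬ c ≈ 0 → c * a ≈ c * b → a ≈ b
  *-cancelˡ-≈ {a} {b} {c} c≉0 ca≈cb =
    *-cancelʳ-≈ c≉0 (subst₂ _≈_ (*-comm c a) (*-comm c b) ca≈cb)

  Square : ℕ → Set
  Square c = ∃ λ x → x * x ≈ c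

  Square-resp : ∀ {a b} → a ≈ b → Square a → Square b
  Square-resp a≈b (x , x²≈a) = x , ≈-trans x²≈a a≈b

  Square-* : ∀ {a b} → Square a → Square b → Square (a * b)
  Square-* (x , x²≈a) (y , y²≈b) = x * y , ≈-trans (≈-reflexive (rearrange x y)) (*-cong x²≈a y²≈b)
    where
    rearrange : ∀ x y → x * y * (x * y) ≡ x * x * (y * y)
    rearrange = solve-∀

  square? : ∀ c → Dec (Square c)
  square? c with Finₚ.any? (λ (i : Fin p) → toℕ i * toℕ i % p ≟ c % p)
  ... | yes (i , e) = yes (toℕ i , mod-≡ e)
  ... | no ¬root = no λ (x , x²≈c) → ¬root (fromℕ< (m%n<n x p) , %-≡ (begin
    toℕ (fromℕ< (m%n<n x p)) * toℕ (fromℕ< (m%n<n x p))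
        ≡⟨ cong (λ t → t * t) (Finₚ.toℕ-fromℕ< (m%n<n x p)) ⟩
    x % p * (x % p)   ≈⟨ *-cong (%-≈ x) (%-≈ x) ⟩
    x * x             ≈⟨ x²≈c ⟩
    c                 ∎))
    where open ≈-Reasoning

  -- u v ≈ (v y x⁻¹)².
  Square-*-of-≈-multiples : ∀ {u v x y} → u * (x * x) ≈ v * (y * y) → ¬ x ≈ 0 → Square (u * v)
  Square-*-of-≈-multiples {u} {v} {x} {y} e x≉0 with *-inverse x≉0
  ... | z , xz≈1 = v * y * z , (begin
    v * y * z * (v * y * z)         ≡⟨ regroup₁ v y z ⟩
    v * (y * y) * (v * (z * z))     ≈⟨ *-congʳ (v * (z * z)) e ⟨
    u * (x * x) * (v * (z * z))     ≡⟨ regroup₂ u v x z ⟩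
    u * v * (x * z * (x * z))       ≈⟨ *-congˡ (u * v) (*-cong xz≈1 xz≈1) ⟩
    u * v * 1                       ≡⟨ *-identityʳ (u * v) ⟩
    u * v                           ∎)
    where
    open ≈-Reasoning
    regroup₁ : ∀ v y z → v * y * z * (v * y * z) ≡ v * (y * y) * (v * (z * z))
    regroup₁ = solve-∀
    regroup₂ : ∀ u v x z → u * (x * x) * (v * (z * z)) ≡ u * v * (x * z * (x * z))
    regroup₂ = solve-∀

odd-prime : ∀ {p} → Prime p → 3 ≤ p → p ≡ suc (p / 2 + p / 2)
odd-prime {p} p-prime 3≤p = begin
  p                       ≡⟨ m≡m%n+[m/n]*n p 2 ⟩
  p % 2 + p / 2 * 2       ≡⟨ cong₂ _+_ p%2≡1 (*-comm (p / 2) 2) ⟩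
  1 + 2 * (p / 2)         ≡⟨ cong (λ k → suc (p / 2 + k)) (+-identityʳ (p / 2)) ⟩
  suc (p / 2 + p / 2)     ∎
  where
  open ≡-Reasoning
  p%2≡1 : p % 2 ≡ 1
  p%2≡1 with p % 2 in eq | m%n<n p 2
  ... | 1 | _ = refl
  ... | 0 | _ with prime⇒irreducible p-prime (divides (p / 2) (trans (m≡m%n+[m/n]*n p 2) (cong (_+ p / 2 * 2) eq)))
  ...   | inj₂ 2≡p = ⊥-elim (<-irrefl 2≡p 3≤p)
  p%2≡1 | 2+ _ | s≤s (s≤s ())

module QuadraticCharacter (p : ℕ) (p-prime : Prime p) (5≤p : 5 ≤ p) where

  open PrimeField p p-prime

  private
    h : ℕ
    h = p / 2

    p≡1+2h : p ≡ suc (h + h)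
    p≡1+2h = odd-prime p-prime (≤-trans (s≤s (s≤s (s≤s z≤n))) 5≤p)

    2h<p : h + h < p
    2h<p = subst (h + h <_) (sym p≡1+2h) ≤-refl

    p<3h : p < 3 * h
    p<3h = begin-strict
      p                 ≡⟨ p≡1+2h ⟩
      1 + (h + h)       <⟨ +-monoˡ-< (h + h) 1<h ⟩
      h + (h + h)       ≡⟨ cong (λ k → h + (h + k)) (+-identityʳ h) ⟨
      3 * h             ∎
      where
      open ≤-Reasoning
      1<h : 1 < h
      1<h = ≰⇒> λ h≤1 → ≤⇒≯ (subst (_≤ 3) (sym p≡1+2h) (s≤s (+-mono-≤ h≤1 h≤1))) (≤-trans (n≤1+n 4) 5≤p)

    [x+t]²≡x²+t[x+t+x] : ∀ x t → (x + t) * (x + t) ≡ x * x + t * (x + t + x)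
    [x+t]²≡x²+t[x+t+x] = solve-∀

  squares-≉ : ∀ x t → 0 < t → x + t ≤ h → ¬ x * x ≈ (x + t) * (x + t)
  squares-≉ x t 0<t x+t≤h x²≈y²
    with euclidsLemma t (x + t + x) p-prime (≈0⇒∣ difference≈0)
    where
    difference≈0 : t * (x + t + x) ≈ 0
    difference≈0 = subst (_≈ 0) (trans (cong (_∸ x * x) ([x+t]²≡x²+t[x+t+x] x t)) (m+n∸m≡n (x * x) _))
      (∸-≈0 (*-mono-≤ (m≤m+n x t) (m≤m+n x t)) x²≈y²)
  ... | inj₁ p∣t = 0<a<p⇒a≉0 0<t (≤-<-trans (≤-trans (m≤n+m t x) x+t≤h) (≤-<-trans (m≤m+n h h) 2h<p)) (∣⇒≈0 p∣t)
  ... | inj₂ p∣2x+t = 0<a<p⇒a≉0 (≤-trans 0<t (≤-trans (m≤n+m t x) (m≤m+n (x + t) x)))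
        (≤-<-trans (+-mono-≤ x+t≤h (≤-trans (m≤m+n x t) x+t≤h)) 2h<p) (∣⇒≈0 p∣2x+t)

  squares-injective : ∀ {x y} → x ≤ h → y ≤ h → x * x ≈ y * y → x ≡ y
  squares-injective {x} {y} x≤h y≤h x²≈y² with <-cmp x y
  ... | tri≈ _ x≡y _ = x≡y
  ... | tri< x<y _ _ = ⊥-elim (squares-≉ x (y ∸ x) (m<n⇒0<n∸m x<y) (subst (_≤ h) y≡x+t y≤h)
                                  (subst (λ y → x * x ≈ y * y) y≡x+t x²≈y²))
    where y≡x+t = sym (m+[n∸m]≡n (<⇒≤ x<y))
  ... | tri> _ _ y<x = ⊥-elim (squares-≉ y (x ∸ y) (m<n⇒0<n∸m y<x) (subst (_≤ h) x≡y+t x≤h)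
                                  (subst (λ x → y * y ≈ x * x) x≡y+t (≈-sym x²≈y²)))
    where x≡y+t = sym (m+[n∸m]≡n (<⇒≤ y<x))

  -- If a, b and ab were all non-squares, the 3h numbers x², a x², b x² (1 ≤ x ≤ h)
  -- would be pairwise incongruent, but p = 2h + 1 < 3h.
  private module ThreeClasses {a b : ℕ} (¬□a : ¬ Square a) (¬□b : ¬ Square b) (¬□ab : ¬ Square (a * b)) where

    coefficient : Fin 3 → ℕ
    coefficient 0F = 1
    coefficient 1F = a
    coefficient 2F = b

    coefficient≉0 : ∀ c → ¬ coefficient c ≈ 0
    coefficient≉0 0F = 0<a<p⇒a≉0 (s≤s z≤n) (≤-trans (s≤s (s≤s z≤n)) 5≤p)
    coefficient≉0 1F a≈0 = ¬□a (0 , ≈-sym a≈0)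
    coefficient≉0 2F b≈0 = ¬□b (0 , ≈-sym b≈0)

    ¬□-reflexive : ∀ {u v} → u ≡ v → ¬ Square u → ¬ Square v
    ¬□-reflexive refl ¬□u = ¬□u

    coefficient-products : ∀ {c c′} → c ≢ c′ → ¬ Square (coefficient c * coefficient c′)
    coefficient-products {0F} {0F} c≢c′ = ⊥-elim (c≢c′ refl)
    coefficient-products {0F} {1F} _ = ¬□-reflexive (sym (*-identityˡ a)) ¬□a
    coefficient-products {0F} {2F} _ = ¬□-reflexive (sym (*-identityˡ b)) ¬□b
    coefficient-products {1F} {0F} _ = ¬□-reflexive (sym (*-identityʳ a)) ¬□a
    coefficient-products {1F} {1F} c≢c′ = ⊥-elim (c≢c′ refl)
    coefficient-products {1F} {2F} _ = ¬□ab
    coefficient-products {2F} {0F} _ = ¬□-reflexive (sym (*-identityʳ b)) ¬□b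
    coefficient-products {2F} {1F} _ = ¬□-reflexive (*-comm a b) ¬□ab
    coefficient-products {2F} {2F} c≢c′ = ⊥-elim (c≢c′ refl)

    scaledSquare : Fin 3 × Fin h → ℕ
    scaledSquare (c , x) = coefficient c * (suc (toℕ x) * suc (toℕ x))

    scaledSquare-injective : ∀ {u v} → scaledSquare u ≈ scaledSquare v → u ≡ v
    scaledSquare-injective {c , x} {c′ , y} e with c Finₚ.≟ c′
    ... | yes refl = cong (c ,_) (Finₚ.toℕ-injective (suc-injective
            (squares-injective (Finₚ.toℕ<n x) (Finₚ.toℕ<n y) (*-cancelˡ-≈ (coefficient≉0 c) e))))
    ... | no c≢c′ = ⊥-elim (coefficient-products c≢c′
            (Square-*-of-≈-multiples {coefficient c} {coefficient c′} {suc (toℕ x)} {suc (toℕ y)} e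
            (0<a<p⇒a≉0 (s≤s z≤n) (≤-<-trans (Finₚ.toℕ<n x) (≤-<-trans (m≤m+n h h) 2h<p)))))

    embed : Fin (3 * h) → Fin p
    embed i = fromℕ< (m%n<n (scaledSquare (remQuot {3} h i)) p)

    embed-injective : ∀ {i j} → embed i ≡ embed j → i ≡ j
    embed-injective {i} {j} e = begin
      i                   ≡⟨ Finₚ.combine-remQuot {3} h i ⟨
      uncurry combine u   ≡⟨ cong (uncurry combine) (scaledSquare-injective {u} {v} (mod-≡ residues≡)) ⟩
      uncurry combine v   ≡⟨ Finₚ.combine-remQuot {3} h j ⟩
      j                   ∎
      where
      open ≡-Reasoning
      u = remQuot {3} h i
      v = remQuot {3} h j
      residues≡ : scaledSquare u % p ≡ scaledSquare v % p
      residues≡ = trans (sym (Finₚ.toℕ-fromℕ< _)) (trans (cong toℕ e) (Finₚ.toℕ-fromℕ< _))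

    absurd : ⊥
    absurd = <⇒≱ p<3h (Finₚ.injective⇒≤ embed-injective)

  nonsquare-*-nonsquare : ∀ {a b} → ¬ Square a → ¬ Square b → Square (a * b)
  nonsquare-*-nonsquare {a} {b} ¬□a ¬□b with square? (a * b)
  ... | yes □ab = □ab
  ... | no ¬□ab = ⊥-elim (ThreeClasses.absurd ¬□a ¬□b ¬□ab)

  nonsquare⇒≉0 : ∀ {a} → ¬ Square a → ¬ a ≈ 0
  nonsquare⇒≉0 ¬□a a≈0 = ¬□a (0 , ≈-sym a≈0)

  square-*-nonsquare : ∀ {a b} → Square a → ¬ a ≈ 0 → ¬ Square b → ¬ Square (a * b)
  square-*-nonsquare {a} {b} (x , x²≈a) a≉0 ¬□b (y , y²≈ab) =
    ¬□b (subst Square (*-identityʳ b) (Square-*-of-≈-multiples {b} {1} {x} {y} bx²≈y² x≉0))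
    where
    x≉0 : ¬ x ≈ 0
    x≉0 x≈0 = a≉0 (≈-trans (≈-sym x²≈a) (*-cong x≈0 x≈0))
    bx²≈y² : b * (x * x) ≈ 1 * (y * y)
    bx²≈y² = begin
      b * (x * x)   ≈⟨ *-congˡ b x²≈a ⟩
      b * a         ≡⟨ *-comm b a ⟩
      a * b         ≈⟨ y²≈ab ⟨
      y * y         ≡⟨ *-identityˡ (y * y) ⟨
      1 * (y * y)   ∎
      where open ≈-Reasoning

  Legendre : ℕ → Sign → Set
  Legendre c Sign.+ = Square c × ¬ c ≈ 0
  Legendre c Sign.- = ¬ Square c

  legendre : ∀ {c} → 0 < c → c < p → Σ Sign (Legendre c)
  legendre {c} 0<c c<p with square? c
  ... | yes □c = Sign.+ , □c , 0<a<p⇒a≉0 0<c c<p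
  ... | no ¬□c = Sign.- , ¬□c

  legendre-* : ∀ {a b} s t → Legendre a s → Legendre b t → Legendre (a * b) (s Sign.* t)
  legendre-* Sign.+ Sign.+ (□a , a≉0) (□b , b≉0) = Square-* □a □b , *-≉0 a≉0 b≉0
  legendre-* Sign.+ Sign.- (□a , a≉0) ¬□b = square-*-nonsquare □a a≉0 ¬□b
  legendre-* {a} {b} Sign.- Sign.+ ¬□a (□b , b≉0) =
    square-*-nonsquare □b b≉0 ¬□a ∘ subst Square (*-comm a b)
  legendre-* Sign.- Sign.- ¬□a ¬□b =
    nonsquare-*-nonsquare ¬□a ¬□b , *-≉0 (nonsquare⇒≉0 ¬□a) (nonsquare⇒≉0 ¬□b)

-- The Cauchy–Davenport theorem

module Sumset (p : ℕ) (p-prime : Prime p) where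

  open PrimeField p p-prime public

  infixl 6 _−ₚ_
  _−ₚ_ : ℕ → ℕ → ℕ
  c −ₚ a = (c + (p ∸ a)) % p

  −ₚ-< : ∀ c a → c −ₚ a < p
  −ₚ-< c a = m%n<n (c + (p ∸ a)) p

  [c−ₚa]+a≈c : ∀ c {a} → a ≤ p → c −ₚ a + a ≈ c
  [c−ₚa]+a≈c c {a} a≤p = ≈-trans (+-congʳ a (%-≈ (c + (p ∸ a)))) ([x+[m∸e]]+e≈x c a≤p)

  [c−ₚa+a]%p≡c : ∀ {c a} → c < p → a ≤ p → (c −ₚ a + a) % p ≡ c
  [c−ₚa+a]%p≡c {c} c<p a≤p = ≈⇒%≡ c<p ([c−ₚa]+a≈c c a≤p)

  [a+[c−ₚa]]%p≡c : ∀ {c a} → c < p → a ≤ p → (a + (c −ₚ a)) % p ≡ c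
  [a+[c−ₚa]]%p≡c {c} {a} c<p a≤p = trans (cong (_% p) (+-comm a (c −ₚ a))) ([c−ₚa+a]%p≡c c<p a≤p)

  [c+a]%p−ₚa≡c : ∀ {c a} → c < p → a ≤ p → (c + a) % p −ₚ a ≡ c
  [c+a]%p−ₚa≡c {c} {a} c<p a≤p = ≈⇒%≡ c<p (≈-trans (+-congʳ (p ∸ a) (%-≈ (c + a))) ([x+e]+[m∸e]≈x c a≤p))

  record IsSumset (f g h : ℕ → Bool) : Set where
    field
      sound : ∀ c → c < p → h c ≡ true →
              ∃₂ λ a b → a < p × b < p × f a ≡ true × g b ≡ true × (a + b) % p ≡ c
      complete : ∀ a b → a < p → b < p → f a ≡ true → g b ≡ true → h ((a + b) % p) ≡ true

  sumset : (f g : ℕ → Bool) → ℕ → Bool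
  sumset f g c = anyBelow p (λ a → f a ∧ g (c −ₚ a))

  sumset-isSumset : ∀ f g → IsSumset f g (sumset f g)
  sumset-isSumset f g = record { sound = sound ; complete = complete }
    where
    sound : ∀ c → c < p → sumset f g c ≡ true →
            ∃₂ λ a b → a < p × b < p × f a ≡ true × g b ≡ true × (a + b) % p ≡ c
    sound c c<p c∈sumset with anyBelow-sound p _ c∈sumset
    ... | a , a<p , fa∧gb = a , c −ₚ a , a<p , −ₚ-< c a ,
            ∧-conicalˡ (f a) _ fa∧gb , ∧-conicalʳ (f a) _ fa∧gb ,
            [a+[c−ₚa]]%p≡c c<p (<⇒≤ a<p)
    complete : ∀ a b → a < p → b < p → f a ≡ true → g b ≡ true → sumset f g ((a + b) % p) ≡ true
    complete a b a<p b<p fa gb = anyBelow-complete p _ a a<p (∧-intro fa (subst (λ t → g t ≡ true) (sym b≡) gb))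
      where
      b≡ : (a + b) % p −ₚ a ≡ b
      b≡ = trans (cong (λ t → t % p −ₚ a) (+-comm a b)) ([c+a]%p−ₚa≡c b<p (<⇒≤ a<p))
      ∧-intro : ∀ {x y} → x ≡ true → y ≡ true → x ∧ y ≡ true
      ∧-intro refl refl = refl

  IsSumset-⊆ : ∀ {f g h h′} → IsSumset f g h → IsSumset f g h′ → ∀ c → c < p → h c ≡ true → h′ c ≡ true
  IsSumset-⊆ {h′ = h′} S S′ c c<p hc with IsSumset.sound S c c<p hc
  ... | a , b , a<p , b<p , fa , gb , a+b≡c = subst (λ t → h′ t ≡ true) a+b≡c (IsSumset.complete S′ a b a<p b<p fa gb)

  IsSumset-count : ∀ {f g h h′} → IsSumset f g h → IsSumset f g h′ → count p h ≡ count p h′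
  IsSumset-count {h = h} {h′} S S′ = count-cong p λ c c<p →
    bool-ext (IsSumset-⊆ S S′ c c<p) (IsSumset-⊆ S′ S c c<p)
    where
    bool-ext : ∀ {x y} → (x ≡ true → y ≡ true) → (y ≡ true → x ≡ true) → x ≡ y
    bool-ext {false} {false} _ _ = refl
    bool-ext {false} {true} _ y⇒x = y⇒x refl
    bool-ext {true} x⇒y _ = sym (x⇒y refl)

  sumset-≥ˡ : ∀ {f g h b} → IsSumset f g h → b < p → g b ≡ true → count p f ≤ count p h
  sumset-≥ˡ {f} {g} {h} {b} S b<p gb = begin
    count p f                      ≡⟨ count-translate (p ∸ b) f ⟨
    count p (λ x → f (x −ₚ b))     ≤⟨ count-mono p shifted-in-h ⟩
    count p h                      ∎
    where
    open ≤-Reasoning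
    shifted-in-h : ∀ x → x < p → f (x −ₚ b) ≡ true → h x ≡ true
    shifted-in-h x x<p fx =
      subst (λ t → h t ≡ true)
        ([c−ₚa+a]%p≡c x<p (<⇒≤ b<p))
        (IsSumset.complete S (x −ₚ b) b (−ₚ-< x b) b<p fx gb)

  sumset-all : ∀ {f g h} → IsSumset f g h → 0 < count p g → (∀ x → x < p → f x ≡ true) → p ≤ count p h
  sumset-all {f} {g} {h} S 0<g f-all with count-witness p g 0<g
  ... | b , b<p , gb = ≤-reflexive (sym (count-all p h h-all))
    where
    h-all : ∀ c → c < p → h c ≡ true
    h-all c c<p = subst (λ t → h t ≡ true)
      ([c−ₚa+a]%p≡c c<p (<⇒≤ b<p))
      (IsSumset.complete S (c −ₚ b) b (−ₚ-< c b) b<p (f-all _ (−ₚ-< c b)) gb)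

  closed-under-+⇒all : ∀ (f : ℕ → Bool) {d} → ¬ d ≈ 0 → (∀ a → a < p → f a ≡ true → f ((a + d) % p) ≡ true) →
                       ∀ {a} → a < p → f a ≡ true → ∀ x → x < p → f x ≡ true
  closed-under-+⇒all f {d} d≉0 closed {a} a<p fa x x<p with *-inverse {d} d≉0
  ... | z , dz≈1 = subst (λ t → f t ≡ true) (≈⇒%≡ x<p reaches-x) (iterate k)
    where
    iterate : ∀ k → f ((a + k * d) % p) ≡ true
    iterate zero = subst (λ t → f t ≡ true) (sym (trans (cong (_% p) (+-identityʳ a)) (m<n⇒m%n≡m a<p))) fa
    iterate (suc k) = subst (λ t → f t ≡ true) (%-≡ step) (closed ((a + k * d) % p) (m%n<n _ p) (iterate k))
      where
      step : (a + k * d) % p + d ≈ a + suc k * d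
      step = ≈-trans (+-congʳ d (%-≈ (a + k * d)))
               (≈-reflexive (trans (+-assoc a (k * d) d) (cong (a +_) (+-comm (k * d) d))))
    k = (x + (p ∸ a)) * z
    reaches-x : a + k * d ≈ x
    reaches-x = begin
      a + (x + (p ∸ a)) * z * d        ≡⟨ cong (a +_) (trans (*-assoc (x + (p ∸ a)) z d) (cong ((x + (p ∸ a)) *_) (*-comm z d))) ⟩
      a + (x + (p ∸ a)) * (d * z)      ≈⟨ +-congˡ a (*-congˡ (x + (p ∸ a)) dz≈1) ⟩
      a + (x + (p ∸ a)) * 1            ≡⟨ trans (cong (a +_) (*-identityʳ _)) (+-comm a _) ⟩
      x + (p ∸ a) + a                  ≈⟨ [x+[m∸e]]+e≈x x (<⇒≤ a<p) ⟩
      x                                ∎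
      where open ≈-Reasoning

  all-or-escape : ∀ f {d} → ¬ d ≈ 0 → 0 < count p f →
    (∀ x → x < p → f x ≡ true) ⊎ ∃ λ a → a < p × f a ≡ true × f ((a + d) % p) ≡ false
  all-or-escape f {d} d≉0 0<f with anyBelow p (λ a → f a ∧ not (f ((a + d) % p))) in escape
  ... | true with anyBelow-sound p _ escape
  ...   | a , a<p , fa∧¬fa+d = inj₂ (a , a<p , ∧-conicalˡ (f a) _ fa∧¬fa+d , not-true (∧-conicalʳ (f a) _ fa∧¬fa+d))
    where
    not-true : ∀ {x} → not x ≡ true → x ≡ false
    not-true {false} _ = refl
  all-or-escape f {d} d≉0 0<f | false with count-witness p f 0<f
  ...   | a , a<p , fa = inj₁ (closed-under-+⇒all f d≉0 closed a<p fa)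
    where
    closed : ∀ a → a < p → f a ≡ true → f ((a + d) % p) ≡ true
    closed a a<p fa with f ((a + d) % p) in fa+d
    ... | true = refl
    ... | false with trans (sym escape) (anyBelow-complete p _ a a<p (cong₂ (λ x y → x ∧ not y) fa fa+d))
    ...   | ()

  module DysonTransform (f g : ℕ → Bool) {e : ℕ} (e≤p : e ≤ p) where

    f′ : ℕ → Bool
    f′ x = f x ∨ g (x −ₚ e)

    g′ : ℕ → Bool
    g′ y = g y ∧ f ((y + e) % p)

    count-preserved : count p f′ + count p g′ ≡ count p f + count p g
    count-preserved = begin
      count p f′ + count p g′                              ≡⟨ cong (count p f′ +_) ∧-translated ⟨
      count p f′ + count p (λ x → f x ∧ g (x −ₚ e))        ≡⟨ count-∨-∧ p f (λ x → g (x −ₚ e)) ⟩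
      count p f + count p (λ x → g (x −ₚ e))               ≡⟨ cong (count p f +_) (count-translate (p ∸ e) g) ⟩
      count p f + count p g                                ∎
      where
      open ≡-Reasoning
      ∧-translated : count p (λ x → f x ∧ g (x −ₚ e)) ≡ count p g′
      ∧-translated = trans (sym (count-translate e (λ x → f x ∧ g (x −ₚ e))))
        (count-cong p λ y y<p → trans (∧-comm (f ((y + e) % p)) _)
          (cong (λ t → g t ∧ f ((y + e) % p)) ([c+a]%p−ₚa≡c y<p e≤p)))

    sumset-⊆ : ∀ {h} → IsSumset f g h → ∀ c → c < p → sumset f′ g′ c ≡ true → h c ≡ true
    sumset-⊆ {h} S c c<p c∈ with IsSumset.sound (sumset-isSumset f′ g′) c c<p c∈
    ... | x , y , x<p , y<p , f′x , g′y , x+y≡c with f x in fx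
    ...   | true = subst (λ t → h t ≡ true) x+y≡c (IsSumset.complete S x y x<p y<p fx (∧-conicalˡ (g y) _ g′y))
    ...   | false = subst (λ t → h t ≡ true) (trans (%-≡ regroup) x+y≡c)
                      (IsSumset.complete S ((y + e) % p) (x −ₚ e) (m%n<n _ p) (−ₚ-< x e) (∧-conicalʳ (g y) _ g′y) f′x)
      where
      regroup : (y + e) % p + (x −ₚ e) ≈ x + y
      regroup = begin
        (y + e) % p + (x −ₚ e)      ≈⟨ +-cong (%-≈ (y + e)) (%-≈ (x + (p ∸ e))) ⟩
        y + e + (x + (p ∸ e))       ≡⟨ y+e+[x+q]≡x+e+q+y y e x (p ∸ e) ⟩
        x + e + (p ∸ e) + y         ≈⟨ +-congʳ y ([x+e]+[m∸e]≈x x e≤p) ⟩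
        x + y                       ∎
        where
        open ≈-Reasoning
        y+e+[x+q]≡x+e+q+y : ∀ y e x q → y + e + (x + q) ≡ x + e + q + y
        y+e+[x+q]≡x+e+q+y = solve-∀

  CauchyDavenportBound : (f g h : ℕ → Bool) → Set
  CauchyDavenportBound f g h = p ≤ count p h ⊎ count p f + count p g ≤ suc (count p h)

  difference≉0 : ∀ {b₁ b₂} → b₁ < p → b₂ < p → b₁ ≢ b₂ → ¬ b₂ −ₚ b₁ ≈ 0
  difference≉0 {b₁} {b₂} b₁<p b₂<p b₁≢b₂ d≈0 = b₁≢b₂ (≈⇒≡ b₁<p b₂<p (begin
    b₁                 ≡⟨ +-identityˡ b₁ ⟨
    0 + b₁             ≈⟨ +-congʳ b₁ d≈0 ⟨
    b₂ −ₚ b₁ + b₁      ≈⟨ [c−ₚa]+a≈c b₂ (<⇒≤ b₁<p) ⟩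
    b₂                 ∎))
    where open ≈-Reasoning

  -- With e = a − b₁, the transformed g′ still contains b₁ but has lost b₂.
  dyson-step : ∀ {f g h a b₁ b₂} → IsSumset f g h → 0 < count p f →
    a < p → b₁ < p → b₂ < p → f a ≡ true → f ((a + (b₂ −ₚ b₁)) % p) ≡ false → g b₁ ≡ true → g b₂ ≡ true →
    (∀ {f′ g′ h′} → count p g′ < count p g → IsSumset f′ g′ h′ → 0 < count p f′ → 0 < count p g′ →
       CauchyDavenportBound f′ g′ h′) →
    CauchyDavenportBound f g h
  dyson-step {f} {g} {h} {a} {b₁} {b₂} S 0<f a<p b₁<p b₂<p fa fa+d≡false gb₁ gb₂ smaller =
    conclude (smaller g′<g (sumset-isSumset f′ g′) 0<f′ (witness⇒0<count p g′ b₁ b₁<p g′b₁))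
    where
    e = a −ₚ b₁
    open DysonTransform f g (<⇒≤ (−ₚ-< a b₁))
    b₁↦a : (b₁ + e) % p ≡ a
    b₁↦a = [a+[c−ₚa]]%p≡c a<p (<⇒≤ b₁<p)
    b₂↦a+d : (b₂ + e) % p ≡ (a + (b₂ −ₚ b₁)) % p
    b₂↦a+d = %-≡ (begin
      b₂ + e                        ≈⟨ +-congˡ b₂ (%-≈ (a + (p ∸ b₁))) ⟩
      b₂ + (a + (p ∸ b₁))           ≡⟨ x+[y+z]≡y+[x+z] b₂ a (p ∸ b₁) ⟩
      a + (b₂ + (p ∸ b₁))           ≈⟨ +-congˡ a (%-≈ (b₂ + (p ∸ b₁))) ⟨
      a + (b₂ −ₚ b₁)                ∎)
      where
      open ≈-Reasoning
      x+[y+z]≡y+[x+z] : ∀ x y z → x + (y + z) ≡ y + (x + z)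
      x+[y+z]≡y+[x+z] = solve-∀
    g′b₁ : g′ b₁ ≡ true
    g′b₁ = trans (cong (λ t → g b₁ ∧ f t) b₁↦a) (cong₂ _∧_ gb₁ fa)
    g′b₂ : g′ b₂ ≡ false
    g′b₂ = trans (cong (λ t → g b₂ ∧ f t) b₂↦a+d) (trans (cong (g b₂ ∧_) fa+d≡false) (∧-zeroʳ (g b₂)))
    g′<g : count p g′ < count p g
    g′<g = count-mono-< p (λ x _ → ∧-conicalˡ (g x) _) b₂ b₂<p g′b₂ gb₂
    0<f′ : 0 < count p f′
    0<f′ = ≤-trans 0<f (count-mono p (λ x _ fx → cong (_∨ g (x −ₚ e)) fx))
    h′≤h : count p (sumset f′ g′) ≤ count p h
    h′≤h = count-mono p (sumset-⊆ S)
    conclude : CauchyDavenportBound f′ g′ (sumset f′ g′) → CauchyDavenportBound f g h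
    conclude (inj₁ p≤h′) = inj₁ (≤-trans p≤h′ h′≤h)
    conclude (inj₂ f′+g′≤1+h′) = inj₂ (≤-trans (≤-reflexive (sym count-preserved)) (≤-trans f′+g′≤1+h′ (s≤s h′≤h)))

  cauchy-davenport : ∀ {f g h} → IsSumset f g h → 0 < count p f → 0 < count p g → CauchyDavenportBound f g h
  cauchy-davenport {g = g} = by-size (count p g) ≤-refl
    where
    by-size : ∀ n {f g h} → count p g ≤ n → IsSumset f g h → 0 < count p f → 0 < count p g →
              CauchyDavenportBound f g h
    by-size zero g≤0 _ _ 0<g = ⊥-elim (<⇒≱ 0<g g≤0)
    by-size (suc n) {f} {g} {h} g≤1+n S 0<f 0<g with 1 <? count p g
    ... | no ¬1<g with count-witness p g 0<g
    ...   | b , b<p , gb = inj₂ (begin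
      count p f + count p g   ≡⟨ cong (count p f +_) (≤-antisym (≮⇒≥ ¬1<g) 0<g) ⟩
      count p f + 1           ≡⟨ +-comm (count p f) 1 ⟩
      suc (count p f)         ≤⟨ s≤s (sumset-≥ˡ S b<p gb) ⟩
      suc (count p h)         ∎)
      where open ≤-Reasoning
    by-size (suc n) {f} {g} {h} g≤1+n S 0<f 0<g | yes 1<g with count-two-witnesses p g 1<g
    ... | b₁ , b₂ , b₁<p , b₂<p , b₁≢b₂ , gb₁ , gb₂ with all-or-escape f (difference≉0 b₁<p b₂<p b₁≢b₂) 0<f
    ...   | inj₁ f-all = inj₁ (sumset-all S 0<g f-all)
    ...   | inj₂ (a , a<p , fa , fa+d≡false) = dyson-step S 0<f a<p b₁<p b₂<p fa fa+d≡false gb₁ gb₂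
              (λ g′<g → by-size n (s≤s⁻¹ (≤-trans g′<g g≤1+n)))

-- Sumsets of subsets of ℤₚ

n≤n+n∸1 : ∀ n → n ≤ n + n ∸ 1
n≤n+n∸1 zero = z≤n
n≤n+n∸1 (suc m) = m≤n+m (suc m) m

+-<-double : ∀ {n i j} → i < n → j < n → i + j < n + n ∸ 1
+-<-double {suc m} (s≤s i≤m) (s≤s j≤m) = ≤-trans (s≤s (+-mono-≤ i≤m j≤m)) (≤-reflexive (sym (+-suc m m)))

<-double-split : ∀ n {k} → k < n + n ∸ 1 → ∃₂ λ i j → i < n × j < n × i + j ≡ k
<-double-split (suc m) {k} k<2m+1 with k ≤? m
... | yes k≤m = k , 0 , s≤s k≤m , z<s , +-identityʳ k
... | no k≰m = m , k ∸ m , ≤-refl , s≤s k∸m≤m , m+[n∸m]≡n (<⇒≤ (≰⇒> k≰m))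
  where
  k∸m≤m : k ∸ m ≤ m
  k∸m≤m = subst (k ∸ m ≤_) (m+n∸m≡n m m) (∸-monoˡ-≤ m (s≤s⁻¹ (subst (k <_) (+-suc m m) k<2m+1)))

module SumsetCardinality (p : ℕ) (p-prime : Prime p) where

  open Sumset p p-prime public

  -- InSumset (in Defs) reduces a + b modulo p by cases.
  %-cases : ∀ {a b} → a < p → b < p → a + b ≡ (a + b) % p ⊎ a + b ≡ (a + b) % p + p
  %-cases {a} {b} a<p b<p with a + b <? p
  ... | yes a+b<p = inj₁ (sym (m<n⇒m%n≡m a+b<p))
  ... | no a+b≮p = inj₂ (begin
    a + b                ≡⟨ m∸n+n≡m p≤a+b ⟨
    a + b ∸ p + p        ≡⟨ cong (_+ p) reduced ⟨
    (a + b) % p + p      ∎)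
    where
    open ≡-Reasoning
    p≤a+b = ≮⇒≥ a+b≮p
    reduced : (a + b) % p ≡ a + b ∸ p
    reduced = trans (sym (m≤n⇒[n∸m]%m≡n%m p≤a+b)) (m<n⇒m%n≡m (+-cancelʳ-< p (a + b ∸ p) p
      (subst (_< p + p) (sym (m∸n+n≡m p≤a+b)) (+-mono-< a<p b<p))))

  cases⇒% : ∀ {a b c} → c < p → (a + b ≡ c ⊎ a + b ≡ c + p) → (a + b) % p ≡ c
  cases⇒% c<p (inj₁ a+b≡c) = trans (cong (_% p) a+b≡c) (m<n⇒m%n≡m c<p)
  cases⇒% {c = c} c<p (inj₂ a+b≡c+p) = trans (cong (_% p) a+b≡c+p) (trans ([m+n]%n≡m%n c p) (m<n⇒m%n≡m c<p))

  SumsetCard⇒IsSumset : ∀ {A : Subset p} {k} (card : SumsetCard A k) →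
                        IsSumset (contains A) (contains A) (contains (proj₁ card))
  SumsetCard⇒IsSumset {A} (B , B≡A+A , _) = record { sound = sound ; complete = complete }
    where
    sound : ∀ c → c < p → contains B c ≡ true →
            ∃₂ λ a b → a < p × b < p × contains A a ≡ true × contains A b ≡ true × (a + b) % p ≡ c
    sound c c<p c∈B with Equivalence.to (B≡A+A (fromℕ< c<p)) (contains-fromℕ< c<p c∈B)
    ... | a , b , a∈A , b∈A , a+b≡c = toℕ a , toℕ b , Finₚ.toℕ<n a , Finₚ.toℕ<n b ,
          ∈⇒contains a∈A , ∈⇒contains b∈A ,
          trans (cases⇒% {toℕ a} {toℕ b} (Finₚ.toℕ<n (fromℕ< c<p)) a+b≡c) (Finₚ.toℕ-fromℕ< c<p)
    complete : ∀ a b → a < p → b < p → contains A a ≡ true → contains A b ≡ true →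
               contains B ((a + b) % p) ≡ true
    complete a b a<p b<p a∈A b∈A = subst (λ t → contains B t ≡ true) (Finₚ.toℕ-fromℕ< (m%n<n (a + b) p))
      (∈⇒contains (Equivalence.from (B≡A+A (fromℕ< (m%n<n (a + b) p)))
        (fromℕ< a<p , fromℕ< b<p , contains-fromℕ< a<p a∈A , contains-fromℕ< b<p b∈A , reduction)))
      where
      reduction : toℕ (fromℕ< a<p) + toℕ (fromℕ< b<p) ≡ toℕ (fromℕ< (m%n<n (a + b) p))
                ⊎ toℕ (fromℕ< a<p) + toℕ (fromℕ< b<p) ≡ toℕ (fromℕ< (m%n<n (a + b) p)) + p
      reduction rewrite Finₚ.toℕ-fromℕ< a<p | Finₚ.toℕ-fromℕ< b<p | Finₚ.toℕ-fromℕ< (m%n<n (a + b) p) =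
        %-cases a<p b<p

  IsSumset⇒SumsetCard : ∀ {A : Subset p} {h} → IsSumset (contains A) (contains A) h → SumsetCard A (count p h)
  IsSumset⇒SumsetCard {A} {h} S = fromPredicate p h , B≡A+A , ∣fromPredicate∣ p h
    where
    B≡A+A : ∀ c → c ∈ fromPredicate p h ⇔ InSumset A c
    B≡A+A c = mk⇔ to from
      where
      to : c ∈ fromPredicate p h → InSumset A c
      to c∈B with IsSumset.sound S (toℕ c) (Finₚ.toℕ<n c)
                    (trans (sym (contains-fromPredicate p h (toℕ c) (Finₚ.toℕ<n c))) (∈⇒contains c∈B))
      ... | a , b , a<p , b<p , a∈A , b∈A , a+b≡c = fromℕ< a<p , fromℕ< b<p ,
            contains-fromℕ< a<p a∈A , contains-fromℕ< b<p b∈A , reduction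
        where
        reduction : toℕ (fromℕ< a<p) + toℕ (fromℕ< b<p) ≡ toℕ c ⊎ toℕ (fromℕ< a<p) + toℕ (fromℕ< b<p) ≡ toℕ c + p
        reduction rewrite Finₚ.toℕ-fromℕ< a<p | Finₚ.toℕ-fromℕ< b<p | sym a+b≡c = %-cases a<p b<p
      from : InSumset A c → c ∈ fromPredicate p h
      from (a , b , a∈A , b∈A , a+b≡c) = contains⇒∈ (trans (contains-fromPredicate p h (toℕ c) (Finₚ.toℕ<n c))
        (subst (λ t → h t ≡ true) (cases⇒% {toℕ a} {toℕ b} (Finₚ.toℕ<n c) a+b≡c)
          (IsSumset.complete S (toℕ a) (toℕ b) (Finₚ.toℕ<n a) (Finₚ.toℕ<n b) (∈⇒contains a∈A) (∈⇒contains b∈A))))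

  SumsetCard-unique : ∀ {A : Subset p} {h k} → IsSumset (contains A) (contains A) h → SumsetCard A k → k ≡ count p h
  SumsetCard-unique {A} S card@(B , _ , ∣B∣≡k) =
    trans (sym ∣B∣≡k) (trans (∣∣≡count B) (IsSumset-count (SumsetCard⇒IsSumset card) S))

  SumsetCard-cauchy-davenport : ∀ {A : Subset p} {k} → SumsetCard A k → 0 < ∣ A ∣ → p ≤ k ⊎ ∣ A ∣ + ∣ A ∣ ≤ suc k
  SumsetCard-cauchy-davenport {A} card@(B , _ , ∣B∣≡k) 0<∣A∣ =
    subst₂ (λ a n → p ≤ n ⊎ a + a ≤ suc n) (sym (∣∣≡count A)) (trans (sym (∣∣≡count B)) ∣B∣≡k)
      (cauchy-davenport (SumsetCard⇒IsSumset card) 0<A 0<A)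
    where
    0<A = subst (0 <_) (∣∣≡count A) 0<∣A∣

  ∣A∣≡5⇒9≤∣A+A∣ : 9 ≤ p → ∀ {A : Subset p} {k} → ∣ A ∣ ≡ 5 → SumsetCard A k → 9 ≤ k
  ∣A∣≡5⇒9≤∣A+A∣ 9≤p ∣A∣≡5 card with SumsetCard-cauchy-davenport card (subst (0 <_) (sym ∣A∣≡5) z<s)
  ... | inj₁ p≤k = ≤-trans 9≤p p≤k
  ... | inj₂ 2∣A∣≤1+k = s≤s⁻¹ (subst (λ a → a + a ≤ suc _) ∣A∣≡5 2∣A∣≤1+k)

  sumsetList : List ℕ → List ℕ
  sumsetList xs = deduplicate _≟_ (map (_% p) (pairSums xs))

  ∈-sumsetList⁻ : ∀ {c} xs → c ∈ₗ sumsetList xs → ∃₂ λ a b → a ∈ₗ xs × b ∈ₗ xs × c ≡ (a + b) % p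
  ∈-sumsetList⁻ xs c∈ with ∈-map⁻ (_% p) (∈-deduplicate⁻ _≟_ (map (_% p) (pairSums xs)) c∈)
  ... | s , s∈ , c≡s%p with ∈-pairSums⁻ xs s∈
  ...   | a , b , a∈ , b∈ , refl = a , b , a∈ , b∈ , c≡s%p

  sumsetList-isSumset : ∀ (A : Subset p) → IsSumset (contains A) (contains A) (_∈ᵇ sumsetList (elements A))
  sumsetList-isSumset A = record { sound = sound ; complete = complete }
    where
    sound : ∀ c → c < p → c ∈ᵇ sumsetList (elements A) ≡ true →
            ∃₂ λ a b → a < p × b < p × contains A a ≡ true × contains A b ≡ true × (a + b) % p ≡ c
    sound c _ c∈ with ∈-sumsetList⁻ (elements A) (∈ᵇ⇒∈ c∈)
    ... | a , b , a∈ , b∈ , c≡a+b =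
            a , b , contains-< A a (∈-elements⁻ {A = A} a∈) , contains-< A b (∈-elements⁻ {A = A} b∈) ,
            ∈-elements⁻ {A = A} a∈ , ∈-elements⁻ {A = A} b∈ , sym c≡a+b
    complete : ∀ a b → a < p → b < p → contains A a ≡ true → contains A b ≡ true →
               ((a + b) % p) ∈ᵇ sumsetList (elements A) ≡ true
    complete a b _ _ a∈A b∈A = ∈⇒∈ᵇ (∈-deduplicate⁺ _≟_ (∈-map⁺ (_% p)
      (∈-pairSums⁺ (∈-elements⁺ {A = A} a∈A) (∈-elements⁺ {A = A} b∈A))))

  count-sumsetList : ∀ xs → count p (_∈ᵇ sumsetList xs) ≡ length (sumsetList xs)
  count-sumsetList xs = count-∈-unique p (deduplicate-! (map (_% p) (pairSums xs))) bounded
    where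
    bounded : ∀ {c} → c ∈ₗ sumsetList xs → c < p
    bounded c∈ with ∈-sumsetList⁻ xs c∈
    ... | a , b , _ , _ , refl = m%n<n (a + b) p

  SumsetCard-sumsetList : ∀ {A : Subset p} {k} → SumsetCard A k → k ≡ length (sumsetList (elements A))
  SumsetCard-sumsetList {A} card =
    trans (SumsetCard-unique (sumsetList-isSumset A) card) (count-sumsetList (elements A))

  module ArithmeticProgression (a d : ℕ) (d≉0 : ¬ d ≈ 0) (n : ℕ) (2n-1≤p : n + n ∸ 1 ≤ p) where

    term : ℕ → ℕ
    term i = (a + i * d) % p

    progression : Subset p
    progression = fromPredicate p (_∈ᵇ applyUpTo term n)

    sumTerm : ℕ → ℕ
    sumTerm k = (a + a + k * d) % p

    shifted-injective : ∀ c {i j} → i < p → j < p → (c + i * d) % p ≡ (c + j * d) % p → i ≡ j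
    shifted-injective c i<p j<p e = ≈⇒≡ i<p j<p (*-cancelʳ-≈ d≉0 (+-cancelˡ-≈ c (mod-≡ e)))

    unique : ∀ f → (∀ {i j} → i < p → j < p → f i ≡ f j → i ≡ j) → ∀ m → m ≤ p → Unique (applyUpTo f m)
    unique f f-injective m m≤p = applyUpTo⁺₁ {A = ℕ} f m λ i<j j<m →
      <⇒≢ i<j ∘ f-injective (<-≤-trans (<-trans i<j j<m) m≤p) (<-≤-trans j<m m≤p)

    count-applyUpTo : ∀ f → (∀ {i j} → i < p → j < p → f i ≡ f j → i ≡ j) → (∀ i → f i < p) →
                      ∀ m → m ≤ p → count p (_∈ᵇ applyUpTo f m) ≡ m
    count-applyUpTo f f-injective f<p m m≤p = trans
      (count-∈-unique p (unique f f-injective m m≤p) bounded)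
      (length-applyUpTo f m)
      where
      bounded : ∀ {x} → x ∈ₗ applyUpTo f m → x < p
      bounded x∈ with ∈-applyUpTo⁻ f x∈
      ... | i , _ , refl = f<p i

    ∣progression∣ : ∣ progression ∣ ≡ n
    ∣progression∣ = trans (∣fromPredicate∣ p (_∈ᵇ applyUpTo term n))
      (count-applyUpTo term (shifted-injective a) (λ i → m%n<n _ p) n (≤-trans (n≤n+n∸1 n) 2n-1≤p))

    term-+ : ∀ i j → (term i + term j) % p ≡ sumTerm (i + j)
    term-+ i j = %-≡ (begin
      term i + term j           ≈⟨ +-cong (%-≈ (a + i * d)) (%-≈ (a + j * d)) ⟩
      a + i * d + (a + j * d)   ≡⟨ regroup a i j d ⟩
      a + a + (i + j) * d       ∎)
      where
      open ≈-Reasoning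
      regroup : ∀ a i j d → a + i * d + (a + j * d) ≡ a + a + (i + j) * d
      regroup = solve-∀

    ∈-progression : ∀ {x} → contains progression x ≡ true → ∃ λ i → i < n × x ≡ term i
    ∈-progression {x} x∈ = ∈-applyUpTo⁻ term (∈ᵇ⇒∈ {xs = applyUpTo term n}
      (trans (sym (contains-fromPredicate p (_∈ᵇ applyUpTo term n) x (contains-< progression x x∈))) x∈))

    term-∈ : ∀ {i} → i < n → contains progression (term i) ≡ true
    term-∈ {i} i<n = trans (contains-fromPredicate p (_∈ᵇ applyUpTo term n) (term i) (m%n<n _ p))
      (∈⇒∈ᵇ {xs = applyUpTo term n} (∈-applyUpTo⁺ term i<n))

    sumsetIsSumTerms : IsSumset (contains progression) (contains progression) (_∈ᵇ applyUpTo sumTerm (n + n ∸ 1))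
    sumsetIsSumTerms = record { sound = sound ; complete = complete }
      where
      sound : ∀ c → c < p → c ∈ᵇ applyUpTo sumTerm (n + n ∸ 1) ≡ true → ∃₂ λ a b → a < p × b < p ×
              contains progression a ≡ true × contains progression b ≡ true × (a + b) % p ≡ c
      sound c _ c∈ with ∈-applyUpTo⁻ sumTerm (∈ᵇ⇒∈ {xs = applyUpTo sumTerm (n + n ∸ 1)} c∈)
      ... | k , k<2n-1 , refl with <-double-split n k<2n-1
      ...   | i , j , i<n , j<n , refl =
              term i , term j , m%n<n _ p , m%n<n _ p , term-∈ i<n , term-∈ j<n , term-+ i j
      complete : ∀ x y → x < p → y < p → contains progression x ≡ true → contains progression y ≡ true →
                 ((x + y) % p) ∈ᵇ applyUpTo sumTerm (n + n ∸ 1) ≡ true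
      complete x y _ _ x∈ y∈ with ∈-progression x∈ | ∈-progression y∈
      ... | i , i<n , refl | j , j<n , refl =
        ∈⇒∈ᵇ {xs = applyUpTo sumTerm (n + n ∸ 1)} (subst (_∈ₗ applyUpTo sumTerm (n + n ∸ 1)) (sym (term-+ i j))
          (∈-applyUpTo⁺ sumTerm (+-<-double i<n j<n)))

    sumsetCard-progression : SumsetCard progression (n + n ∸ 1)
    sumsetCard-progression = subst (SumsetCard progression)
      (count-applyUpTo sumTerm (shifted-injective (a + a)) (λ k → m%n<n _ p) (n + n ∸ 1) 2n-1≤p)
      (IsSumset⇒SumsetCard sumsetIsSumTerms)

  Square⇒IsSquare : ∀ (c : Fin p) → Square (toℕ c) → IsSquare p c
  Square⇒IsSquare c (x , x²≈c) = fromℕ< (m%n<n x p) , r * r / p , (begin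
    toℕ (fromℕ< (m%n<n x p)) * toℕ (fromℕ< (m%n<n x p))  ≡⟨ cong (λ t → t * t) (Finₚ.toℕ-fromℕ< (m%n<n x p)) ⟩
    r * r                                               ≡⟨ m≡m%n+[m/n]*n (r * r) p ⟩
    r * r % p + r * r / p * p                           ≡⟨ cong (_+ r * r / p * p) r²%p≡c ⟩
    toℕ c + r * r / p * p                               ∎)
    where
    open ≡-Reasoning
    r = x % p
    r²%p≡c : r * r % p ≡ toℕ c
    r²%p≡c = trans (%-≡ (≈-trans (*-cong (%-≈ x) (%-≈ x)) x²≈c)) (m<n⇒m%n≡m (Finₚ.toℕ<n c))

  squaresOf : List ℕ → List ℕ
  squaresOf roots = map (λ x → x * x % p) roots

  fromRoots : List ℕ → Subset p
  fromRoots roots = fromPredicate p (_∈ᵇ squaresOf roots)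

  fromRoots-IsSquare : ∀ roots (c : Fin p) → c ∈ fromRoots roots → IsSquare p c
  fromRoots-IsSquare roots c c∈ with ∈-map⁻ (λ x → x * x % p) (∈ᵇ⇒∈ {xs = squaresOf roots}
    (trans (sym (contains-fromPredicate p (_∈ᵇ squaresOf roots) (toℕ c) (Finₚ.toℕ<n c))) (∈⇒contains c∈)))
  ... | x , _ , c≡x²%p = Square⇒IsSquare c (x , ≈-trans (≈-sym (%-≈ (x * x))) (≈-reflexive (sym c≡x²%p)))

  squareMask : Subset p
  squareMask = fromRoots (upTo p)

  IsSquare⇒∈squareMask : ∀ {c} → IsSquare p c → c ∈ squareMask
  IsSquare⇒∈squareMask {c} (x , k , x²≡c+kp) =
    contains⇒∈ (trans (contains-fromPredicate p (_∈ᵇ squaresOf (upTo p)) (toℕ c) (Finₚ.toℕ<n c))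
      (∈⇒∈ᵇ {xs = squaresOf (upTo p)}
        (subst (_∈ₗ squaresOf (upTo p)) x²%p≡c (∈-map⁺ (λ x → x * x % p) (∈-upTo⁺ (Finₚ.toℕ<n x))))))
    where
    x²%p≡c : toℕ x * toℕ x % p ≡ toℕ c
    x²%p≡c = trans (cong (_% p) x²≡c+kp) (trans ([m+kn]%n≡m%n (toℕ c) k p) (m<n⇒m%n≡m (Finₚ.toℕ<n c)))

  sumsetSize : Subset p → ℕ
  sumsetSize A = length (sumsetList (elements A))

  SumsetCard-sumsetSize : ∀ (A : Subset p) → SumsetCard A (sumsetSize A)
  SumsetCard-sumsetSize A =
    subst (SumsetCard A) (count-sumsetList (elements A)) (IsSumset⇒SumsetCard (sumsetList-isSumset A))

  LowerBoundCertificate : ℕ → Set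
  LowerBoundCertificate m = All (λ A → m ≤ sumsetSize A) (subsetsOfSize squareMask 5)

  lowerBound? : ∀ m → Dec (LowerBoundCertificate m)
  lowerBound? m = All.all? (λ A → m ≤? sumsetSize A) (subsetsOfSize squareMask 5)

  certified-lower-bound : ∀ {m} → LowerBoundCertificate m →
    (A : Subset p) → SquareSubset p 5 A → (k : ℕ) → SumsetCard A k → m ≤ k
  certified-lower-bound cert A (squares , ∣A∣≡5) k card =
    subst (_ ≤_) (sym (SumsetCard-sumsetList card))
      (All.lookup cert (subst (λ n → A ∈ₗ subsetsOfSize squareMask n) ∣A∣≡5
        (∈-subsetsOfSize (λ {c} c∈A → IsSquare⇒∈squareMask (squares c c∈A)))))

  IsN-fromRoots : ∀ m roots → ∣ fromRoots roots ∣ ≡ 5 → sumsetSize (fromRoots roots) ≡ m →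
    ((A : Subset p) → SquareSubset p 5 A → (k : ℕ) → SumsetCard A k → m ≤ k) → IsN 5 p m
  IsN-fromRoots m roots ∣A∣≡5 size≡m lower-bound =
    (fromRoots roots , (fromRoots-IsSquare roots , ∣A∣≡5) , subst (SumsetCard _) size≡m (SumsetCard-sumsetSize _)) ,
    lower-bound

-- Five-term progressions of squares for p ≥ 41

smallPrime : Fin 7 → ℕ
smallPrime = lookup (2 ∷ 3 ∷ 5 ∷ 7 ∷ 11 ∷ 13 ∷ 17 ∷ [])

smallPrime-positive : ∀ i → 0 < smallPrime i
smallPrime-positive = from-yes (Finₚ.all? λ i → 1 ≤? smallPrime i)

smallPrime-<41 : ∀ i → smallPrime i < 41
smallPrime-<41 = from-yes (Finₚ.all? λ i → suc (smallPrime i) ≤? 41)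

factorise : (fuel n : ℕ) → List (Fin 7)
factorise zero _ = []
factorise (suc fuel) n = firstDivisor (allFin 7)
  where
  firstDivisor : List (Fin 7) → List (Fin 7)
  firstDivisor [] = []
  firstDivisor (i ∷ is) with smallPrime i ∣? n
  ... | yes i∣n = i ∷ factorise fuel (quotient i∣n)
  ... | no _ = firstDivisor is

primeProduct : List (Fin 7) → ℕ
primeProduct = foldr (λ i n → smallPrime i * n) 1

signProduct : Vec Sign 7 → List (Fin 7) → Sign
signProduct σ = foldr (λ i s → lookup σ i Sign.* s) Sign.+

certifiedWithSign : Sign → Vec Sign 7 → ℕ → Bool
certifiedWithSign s σ n =
  (primeProduct (factorise n n) ≡ᵇ n) ∧ does (s Sign.* signProduct σ (factorise n n) Sign.≟ Sign.+)

-- A sign vector σ₋ ∷ σ guesses the Legendre symbols of -1 and of the seven small primes; an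
-- integer is certified to be a square when it is 0 or factors over the small primes with
-- total symbol +.
certifiedSquare : Vec Sign 8 → ℤ → Bool
certifiedSquare _ (ℤ.+ zero) = true
certifiedSquare (_ ∷ σ) (ℤ.+ suc n) = certifiedWithSign Sign.+ σ (suc n)
certifiedSquare (σ₋ ∷ σ) ℤ.-[1+ n ] = certifiedWithSign σ₋ σ (suc n)

module _ where
  open import Data.Sign using (+; -)

  -- First term and common difference of a progression of certified squares, by the symbols
  -- of -1, 2, 3, 5, 7, 11, 13, 17 (first matching clause).
  progressionOfSquares : Vec Sign 8 → ℤ × ℕ
  progressionOfSquares (_ ∷ + ∷ + ∷ _) = + ◃ 0 , 1
  progressionOfSquares (+ ∷ + ∷ - ∷ _) = - ◃ 2 , 1
  progressionOfSquares (- ∷ + ∷ - ∷ + ∷ + ∷ + ∷ _) = + ◃ 7 , 1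
  progressionOfSquares (- ∷ + ∷ - ∷ + ∷ + ∷ - ∷ + ∷ _) = + ◃ 1 , 3
  progressionOfSquares (- ∷ + ∷ - ∷ + ∷ + ∷ - ∷ - ∷ _) = - ◃ 75 , 31
  progressionOfSquares (- ∷ + ∷ - ∷ + ∷ - ∷ _) = - ◃ 7 , 4
  progressionOfSquares (- ∷ + ∷ - ∷ - ∷ _) = - ◃ 12 , 7
  progressionOfSquares (+ ∷ - ∷ + ∷ + ∷ _) = - ◃ 5 , 2
  progressionOfSquares (- ∷ - ∷ + ∷ + ∷ + ∷ _) = + ◃ 1 , 2
  progressionOfSquares (- ∷ - ∷ + ∷ + ∷ - ∷ _) = - ◃ 32 , 11
  progressionOfSquares (+ ∷ - ∷ + ∷ - ∷ + ∷ + ∷ + ∷ _) = - ◃ 13 , 1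
  progressionOfSquares (+ ∷ - ∷ + ∷ - ∷ + ∷ + ∷ - ∷ _) = - ◃ 100 , 37
  progressionOfSquares (+ ∷ - ∷ + ∷ - ∷ + ∷ - ∷ _) = - ◃ 28 , 6
  progressionOfSquares (+ ∷ - ∷ + ∷ - ∷ - ∷ _) = - ◃ 40 , 13
  progressionOfSquares (- ∷ - ∷ + ∷ - ∷ _) = - ◃ 8 , 3
  progressionOfSquares (+ ∷ - ∷ - ∷ + ∷ + ∷ + ∷ _) = - ◃ 16 , 5
  progressionOfSquares (+ ∷ - ∷ - ∷ + ∷ + ∷ - ∷ + ∷ + ∷ []) = - ◃ 17 , 4
  progressionOfSquares (+ ∷ - ∷ - ∷ + ∷ + ∷ - ∷ + ∷ - ∷ []) = - ◃ 80 , 29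
  progressionOfSquares (+ ∷ - ∷ - ∷ + ∷ + ∷ - ∷ - ∷ _) = - ◃ 30 , 2
  progressionOfSquares (+ ∷ - ∷ - ∷ + ∷ - ∷ _) = - ◃ 14 , 5
  progressionOfSquares (+ ∷ - ∷ - ∷ - ∷ + ∷ + ∷ _) = - ◃ 16 , 5
  progressionOfSquares (+ ∷ - ∷ - ∷ - ∷ + ∷ - ∷ _) = - ◃ 28 , 6
  progressionOfSquares (+ ∷ - ∷ - ∷ - ∷ - ∷ _) = - ◃ 14 , 5
  progressionOfSquares (- ∷ - ∷ - ∷ + ∷ + ∷ + ∷ _) = - ◃ 27 , 19
  progressionOfSquares (- ∷ - ∷ - ∷ + ∷ + ∷ - ∷ _) = - ◃ 11 , 9
  progressionOfSquares (- ∷ - ∷ - ∷ + ∷ - ∷ _) = - ◃ 7 , 4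
  progressionOfSquares (- ∷ - ∷ - ∷ - ∷ _) = - ◃ 8 , 3

progressionTerm : ℤ × ℕ → ℕ → ℤ
progressionTerm (s , d) i = s ℤ.+ ℤ.+ (i * d)

CertifiedProgression : Vec Sign 8 → Set
CertifiedProgression σ = 0 < step × step < 41 ×
  (∀ (i : Fin 5) → certifiedSquare σ (progressionTerm (progressionOfSquares σ) (toℕ i)) ≡ true)
  where step = proj₂ (progressionOfSquares σ)

certifiedProgression? : ∀ σ → Dec (CertifiedProgression σ)
certifiedProgression? σ = 0 <? step ×-dec step <? 41 ×-dec
  Finₚ.all? (λ i → certifiedSquare σ (progressionTerm (progressionOfSquares σ) (toℕ i)) Boolₚ.≟ true)
  where step = proj₂ (progressionOfSquares σ)

∀-signs? : ∀ n {P : Vec Sign n → Set} → (∀ σ → Dec (P σ)) → Dec (∀ σ → P σ)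
∀-signs? zero P? = map′ (λ P[] → λ { [] → P[] }) (λ ∀P → ∀P []) (P? [])
∀-signs? (suc n) P? = map′
  (λ (∀P₊ , ∀P₋) → λ { (Sign.+ ∷ σ) → ∀P₊ σ ; (Sign.- ∷ σ) → ∀P₋ σ })
  (λ ∀P → ∀P ∘ (Sign.+ ∷_) , ∀P ∘ (Sign.- ∷_))
  (∀-signs? n (P? ∘ (Sign.+ ∷_)) ×-dec ∀-signs? n (P? ∘ (Sign.- ∷_)))

-- Abstract, so that uses do not unfold the 2⁸-case decision.
abstract
  all-certified : ∀ σ → CertifiedProgression σ
  all-certified = from-yes (∀-signs? 8 certifiedProgression?)

module LargePrimes (p : ℕ) (p-prime : Prime p) (41≤p : 41 ≤ p) where

  private
    5≤p : 5 ≤ p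
    5≤p = ≤-trans (m≤m+n 5 36) 41≤p

  open SumsetCardinality p p-prime
  open QuadraticCharacter p p-prime 5≤p

  -- A natural number congruent to t modulo p, with -1 represented by p - 1.
  ⟦_⟧ : ℤ → ℕ
  ⟦ ℤ.+ n ⟧ = n
  ⟦ ℤ.-[1+ n ] ⟧ = (p ∸ 1) * suc n

  [p∸1]*k+k≈0 : ∀ k → (p ∸ 1) * k + k ≈ 0
  [p∸1]*k+k≈0 k = begin
    (p ∸ 1) * k + k         ≡⟨ cong ((p ∸ 1) * k +_) (*-identityˡ k) ⟨
    (p ∸ 1) * k + 1 * k     ≡⟨ *-distribʳ-+ k (p ∸ 1) 1 ⟨
    (p ∸ 1 + 1) * k         ≡⟨ cong (_* k) (m∸n+n≡m (≤-trans (s≤s z≤n) 5≤p)) ⟩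
    p * k                   ≈⟨ m*≈0 k ⟩
    0                       ∎
    where open ≈-Reasoning

  ⟦-+⟧ : ∀ m → ⟦ ℤ.- ℤ.+ m ⟧ ≈ (p ∸ 1) * m
  ⟦-+⟧ zero = ≈-reflexive (sym (*-zeroʳ (p ∸ 1)))
  ⟦-+⟧ (suc m) = ≈-refl

  ⟦⊖⟧ : ∀ m k → ⟦ m ℤ.⊖ k ⟧ ≈ (p ∸ 1) * k + m
  ⟦⊖⟧ m k with ≤-total k m
  ... | inj₁ k≤m rewrite ℤₚ.⊖-≥ k≤m = +-cancelʳ-≈ k (begin
    m ∸ k + k                   ≡⟨ m∸n+n≡m k≤m ⟩
    m                           ≡⟨ +-identityˡ m ⟨
    0 + m                       ≈⟨ +-congʳ m ([p∸1]*k+k≈0 k) ⟨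
    (p ∸ 1) * k + k + m         ≡⟨ x+y+z≡x+z+y ((p ∸ 1) * k) k m ⟩
    (p ∸ 1) * k + m + k         ∎)
    where
    open ≈-Reasoning
    x+y+z≡x+z+y : ∀ x y z → x + y + z ≡ x + z + y
    x+y+z≡x+z+y = solve-∀
  ... | inj₂ m≤k rewrite ℤₚ.⊖-≤ m≤k = begin
    ⟦ ℤ.- ℤ.+ (k ∸ m) ⟧                     ≈⟨ ⟦-+⟧ (k ∸ m) ⟩
    (p ∸ 1) * (k ∸ m)                       ≡⟨ +-identityʳ _ ⟨
    (p ∸ 1) * (k ∸ m) + 0                   ≈⟨ +-congˡ ((p ∸ 1) * (k ∸ m)) ([p∸1]*k+k≈0 m) ⟨
    (p ∸ 1) * (k ∸ m) + ((p ∸ 1) * m + m)   ≡⟨ +-assoc ((p ∸ 1) * (k ∸ m)) _ m ⟨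
    (p ∸ 1) * (k ∸ m) + (p ∸ 1) * m + m     ≡⟨ cong (_+ m) (*-distribˡ-+ (p ∸ 1) (k ∸ m) m) ⟨
    (p ∸ 1) * (k ∸ m + m) + m               ≡⟨ cong (λ t → (p ∸ 1) * t + m) (m∸n+n≡m m≤k) ⟩
    (p ∸ 1) * k + m                         ∎
    where open ≈-Reasoning

  ⟦+⟧ : ∀ s n → ⟦ s ℤ.+ ℤ.+ n ⟧ ≈ ⟦ s ⟧ + n
  ⟦+⟧ (ℤ.+ m) n = ≈-refl
  ⟦+⟧ ℤ.-[1+ m ] n = ⟦⊖⟧ n (suc m)

  legendre[1] : Legendre 1 Sign.+
  legendre[1] = (1 , ≈-refl) , 0<a<p⇒a≉0 z<s (≤-trans (s≤s (s≤s z≤n)) 5≤p)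

  legendre-primeProduct : ∀ σ → (∀ i → Legendre (smallPrime i) (lookup σ i)) →
                          ∀ fs → Legendre (primeProduct fs) (signProduct σ fs)
  legendre-primeProduct σ χ [] = legendre[1]
  legendre-primeProduct σ χ (i ∷ fs) = legendre-* (lookup σ i) _ (χ i) (legendre-primeProduct σ χ fs)

  certifiedWithSign-sound : ∀ {a s} σ n → Legendre a s → (∀ i → Legendre (smallPrime i) (lookup σ i)) →
                            certifiedWithSign s σ n ≡ true → Square (a * n)
  certifiedWithSign-sound {a} {s} σ n χa χ certified = subst Square (cong (a *_) product≡n)
    (proj₁ (subst (Legendre (a * primeProduct fs)) sign≡+ (legendre-* s _ χa (legendre-primeProduct σ χ fs))))
    where
    fs = factorise n n
    product≡n : primeProduct fs ≡ n
    product≡n = ≡ᵇ⇒≡ _ n (Equivalence.from T-≡ (∧-conicalˡ _ _ certified))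
    sign≡+ : s Sign.* signProduct σ fs ≡ Sign.+
    sign≡+ = does⇒ (_ Sign.≟ Sign.+) (∧-conicalʳ _ _ certified)

  certifiedSquare-sound : ∀ σ₋ σ → Legendre (p ∸ 1) σ₋ → (∀ i → Legendre (smallPrime i) (lookup σ i)) →
                          ∀ t → certifiedSquare (σ₋ ∷ σ) t ≡ true → Square ⟦ t ⟧
  certifiedSquare-sound σ₋ σ χ₋ χ (ℤ.+ zero) _ = 0 , ≈-refl
  certifiedSquare-sound σ₋ σ χ₋ χ (ℤ.+ suc n) certified = subst Square (*-identityˡ (suc n))
    (certifiedWithSign-sound σ (suc n) legendre[1] χ certified)
  certifiedSquare-sound σ₋ σ χ₋ χ ℤ.-[1+ n ] certified = certifiedWithSign-sound σ (suc n) χ₋ χ certified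

  legendre[-1] : Σ Sign (Legendre (p ∸ 1))
  legendre[-1] = legendre (∸-monoˡ-≤ 1 (≤-trans (s≤s (s≤s z≤n)) 5≤p)) (∸-monoʳ-< {p} {1} {0} z<s (≤-trans (s≤s z≤n) 5≤p))

  legendre[smallPrime] : ∀ i → Σ Sign (Legendre (smallPrime i))
  legendre[smallPrime] i = legendre (smallPrime-positive i) (<-≤-trans (smallPrime-<41 i) 41≤p)

  legendreSymbols : Vec Sign 8
  legendreSymbols = proj₁ legendre[-1] ∷ tabulate (proj₁ ∘ legendre[smallPrime])

  squareProgression : ∃₂ λ a d → ¬ d ≈ 0 × ∀ i → i < 5 → Square ((a + i * d) % p)
  squareProgression = ⟦ s ⟧ , d , 0<a<p⇒a≉0 0<d (<-≤-trans d<41 41≤p) , λ i i<5 →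
    Square-resp (≈-trans (⟦+⟧ s (i * d)) (≈-sym (%-≈ _)))
      (certifiedSquare-sound _ _ (proj₂ legendre[-1]) χ (progressionTerm (s , d) i)
        (subst (λ j → certifiedSquare legendreSymbols (progressionTerm (s , d) j) ≡ true)
          (Finₚ.toℕ-fromℕ< i<5) (terms-certified (fromℕ< i<5))))
    where
    s = proj₁ (progressionOfSquares legendreSymbols)
    d = proj₂ (progressionOfSquares legendreSymbols)
    0<d = proj₁ (all-certified legendreSymbols)
    d<41 = proj₁ (proj₂ (all-certified legendreSymbols))
    terms-certified = proj₂ (proj₂ (all-certified legendreSymbols))
    χ : ∀ i → Legendre (smallPrime i) (lookup (tabulate (proj₁ ∘ legendre[smallPrime])) i)
    χ i = subst (Legendre (smallPrime i)) (sym (lookup∘tabulate (proj₁ ∘ legendre[smallPrime]) i))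
            (proj₂ (legendre[smallPrime] i))

  upper-bound : ∃ λ A → SquareSubset p 5 A × SumsetCard A 9
  upper-bound with squareProgression
  ... | a , d , d≉0 , squares = progression , (progression-squares , ∣progression∣) , sumsetCard-progression
    where
    open ArithmeticProgression a d d≉0 5 (≤-trans (m≤m+n 9 32) 41≤p)
    progression-squares : (c : Fin p) → c ∈ progression → IsSquare p c
    progression-squares c c∈ with ∈-progression (∈⇒contains c∈)
    ... | i , i<5 , c≡term = Square⇒IsSquare c (subst Square (sym c≡term) (squares i i<5))

mainTheorem10 : (p : ℕ) → Prime p → 11 ≤ p →
    ((p ≡ 17 ⊎ p ≡ 23 ⊎ 41 ≤ p) → IsN 5 p 9) ×
    ((p ≡ 11 ⊎ p ≡ 19 ⊎ p ≡ 29 ⊎ p ≡ 31 ⊎ p ≡ 37) → IsN 5 p 10) ×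
    (p ≡ 13 → IsN 5 p 11)
mainTheorem10 p p-prime 11≤p = nine , ten , eleven
  where
  open SumsetCardinality p p-prime
  lower-nine : (A : Subset p) → SquareSubset p 5 A → (k : ℕ) → SumsetCard A k → 9 ≤ k
  lower-nine A (_ , ∣A∣≡5) k = ∣A∣≡5⇒9≤∣A+A∣ (≤-trans (m≤m+n 9 2) 11≤p) ∣A∣≡5

  nine : (p ≡ 17 ⊎ p ≡ 23 ⊎ 41 ≤ p) → IsN 5 p 9
  nine (inj₁ refl) = IsN-fromRoots 9 (0 ∷ 1 ∷ 6 ∷ 7 ∷ 4 ∷ []) refl refl lower-nine
  nine (inj₂ (inj₁ refl)) = IsN-fromRoots 9 (0 ∷ 1 ∷ 5 ∷ 7 ∷ 2 ∷ []) refl refl lower-nine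
  nine (inj₂ (inj₂ 41≤p)) = LargePrimes.upper-bound p p-prime 41≤p , lower-nine

  ten : (p ≡ 11 ⊎ p ≡ 19 ⊎ p ≡ 29 ⊎ p ≡ 31 ⊎ p ≡ 37) → IsN 5 p 10
  ten (inj₁ refl) = IsN-fromRoots 10 (1 ∷ 5 ∷ 2 ∷ 4 ∷ 3 ∷ []) refl refl
      (certified-lower-bound (from-yes (lowerBound? 10)))
  ten (inj₂ (inj₁ refl)) = IsN-fromRoots 10 (1 ∷ 2 ∷ 5 ∷ 3 ∷ 6 ∷ []) refl refl
      (certified-lower-bound (from-yes (lowerBound? 10)))
  ten (inj₂ (inj₂ (inj₁ refl))) = IsN-fromRoots 10 (1 ∷ 2 ∷ 6 ∷ 7 ∷ 9 ∷ []) refl refl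
      (certified-lower-bound (from-yes (lowerBound? 10)))
  ten (inj₂ (inj₂ (inj₂ (inj₁ refl)))) = IsN-fromRoots 10 (1 ∷ 8 ∷ 15 ∷ 13 ∷ 12 ∷ []) refl refl
      (certified-lower-bound (from-yes (lowerBound? 10)))
  ten (inj₂ (inj₂ (inj₂ (inj₂ refl)))) = IsN-fromRoots 10 (1 ∷ 15 ∷ 9 ∷ 16 ∷ 6 ∷ []) refl refl
      (certified-lower-bound (from-yes (lowerBound? 10)))

  eleven : p ≡ 13 → IsN 5 p 11
  eleven refl = IsN-fromRoots 11 (0 ∷ 1 ∷ 4 ∷ 2 ∷ 6 ∷ []) refl refl
    (certified-lower-bound (from-yes (lowerBound? 11)))
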